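{- Let $p$ be a program of the split fireball calculus and let $\vec x=(x_1,\dots,x_n)$ be a list of variables suitable for $p$. The following are equivalent: (1) the evaluation of $p$ terminates, i.e. there is a normal program $q$ with $p\to_{\beta_f}^* q$; (2) there is a type derivation of $\Gamma\vdash p:M$ for some type context $\Gamma$ and multi type $M$; (3) $[\![p]\!]_{\vec x}\neq\emptyset$.
   Context: Terms: $t,u ::= x \mid \lambda x.t \mid tu$, up to $\alpha$-equivalence; $t\{x\leftarrow u\}$ is capture-avoiding substitution. Values: $v ::= x \mid \lambda x.t$. Fireballs $f$ and inert terms $i$ are defined by mutual induction: $f ::= v \mid i$ and $i ::= x f_1 \dots f_n$ with $n>0$. Right evaluation contexts: $C ::= \langle\cdot\rangle \mid t\,C \mid C\,f$. Split fireball calculus: environments $E ::= \epsilon \mid [x\leftarrow i]:E$; programs $p=(t,E)$. Append: $\epsilon@[x\leftarrow i]=[x\leftarrow i]$, $([y\leftarrow i']:E)@[x\leftarrow i]=[y\leftarrow i']:(E@[x\leftarrow i])$. Free variables: $\mathrm{fv}((t,\epsilon))=\mathrm{fv}(t)$, $\mathrm{fv}((t,E@[x\leftarrow i]))=(\mathrm{fv}((t,E))\setminus\{x\})\cup\mathrm{fv}(i)$. Reduction: $(C\langle(\lambda x.t)v\rangle,E)\to_{\beta_v}(C\langle t\{x\leftarrow v\}\rangle,E)$ and $(C\langle(\lambda x.t)i\rangle,E)\to_{\beta_i}(C\langle t\rangle,[x\leftarrow i]:E)$; $\to_{\beta_f}=\to_{\beta_v}\cup\to_{\beta_i}$; a program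 is normal if it has no $\to_{\beta_f}$-reduct. Multi types: linear types $L ::= M\multimap N$; multi types $M,N ::= [L_1,\dots,L_n]$ (finite multisets, $n\ge 0$); $\mathbf 0$ empty multiset, $\uplus$ multiset sum. Type context $\Gamma$: total map from variables to multi types with finite $\mathrm{dom}(\Gamma)=\{x\mid \Gamma(x)\ne\mathbf 0\}$; $(\Gamma\uplus\Delta)(x)=\Gamma(x)\uplus\Delta(x)$; $x_1:M_1,\dots,x_n:M_n$ maps $x_k$ to $M_k$ and all else to $\mathbf 0$; $\Gamma,x:M$ extends $\Gamma$ ($x\notin\mathrm{dom}(\Gamma)$) by $x\mapsto M$. Typing rules: (ax) $x:M\vdash x:M$; (@) from $\Gamma\vdash t:[M\multimap N]$ and $\Delta\vdash u:M$ infer $\Gamma\uplus\Delta\vdash tu:N$; ($\lambda$) from $\Gamma_k,x:M_k\vdash t:N_k$ for $k=1,\dots,n$ ($n\ge0$) infer $\Gamma_1\uplus\dots\uplus\Gamma_n\vdash\lambda x.t:[M_1\multimap N_1,\dots,M_n\multimap N_n]$; (es$_\epsilon$) from $\Gamma\vdash t:M$ infer $\Gamma\vdash (t,\epsilon):M$; (es$_@$) from $\Gamma,x:M\vdash(t,E):N$ and $\Delta\vdash i:M$ infer $\Gamma\uplus\Delta\vdash(t,E@[x\leftarrow i]):N$. A list $\vec x=(x_1,\dots,x_n)$ of pairwise distinct variables is suitable for $p$ if $\mathrm{fv}(p)\subseteq\{x_1,\dots,x_n\}$, and then $[\![p]\!]_{\vec x}=\{((M_1,\dots,M_n),N)\mid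 \text{there is a derivation of } x_1:M_1,\dots,x_n:M_n\vdash p:N\}$. -}

module Defs where

open import Data.Nat using (ℕ; zero; suc; _≟_)
open import Data.Fin using (Fin; zero; suc)
open import Data.List using (List; []; _∷_; _++_; [_]; length)
open import Data.List.Membership.Propositional using (_∈_)
open import Data.List.Relation.Unary.Unique.Propositional using (Unique)
open import Data.Vec using (Vec; []; _∷_)
open import Data.Product using (Σ; _×_; _,_; ∃; ∃-syntax)
open import Relation.Nullary using (¬_; yes; no)
open import Relation.Binary.PropositionalEquality using (_≡_; _≢_)
open import Relation.Binary.Construct.Closure.ReflexiveTransitive using (Star)

-- Terms, locally nameless and well-scoped: free variables are names (ℕ),
-- bound variables are de Bruijn indices (Fin n).  This represents terms
-- up to α-equivalence.

Var : Set
Var = ℕ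

data Tm (n : ℕ) : Set where
  fvar : Var → Tm n
  bvar : Fin n → Tm n
  lam  : Tm (suc n) → Tm n
  app  : Tm n → Tm n → Tm n

Term : Set
Term = Tm 0

ren : ∀ {n m} → (Fin n → Fin m) → Tm n → Tm m
ren ρ (fvar x)  = fvar x
ren ρ (bvar k)  = bvar (ρ k)
ren ρ (lam t)   = lam (ren (λ { zero → zero ; (suc k) → suc (ρ k) }) t)
ren ρ (app t u) = app (ren ρ t) (ren ρ u)

sub : ∀ {n m} → (Fin n → Tm m) → Tm n → Tm m
sub σ (fvar x)  = fvar x
sub σ (bvar k)  = σ k
sub σ (lam t)   = lam (sub (λ { zero → bvar zero ; (suc k) → ren suc (σ k) }) t)
sub σ (app t u) = app (sub σ t) (sub σ u)

-- opening the body of λx.t with a term u : t{x←u}  (capture-avoiding)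
open₀ : Tm 1 → Term → Term
open₀ t u = sub (λ { zero → u }) t

data Free (x : Var) : ∀ {n} → Tm n → Set where
  fv-var : ∀ {n} → Free x {n} (fvar x)
  fv-lam : ∀ {n} {t : Tm (suc n)} → Free x t → Free x (lam t)
  fv-appl : ∀ {n} {t u : Tm n} → Free x t → Free x (app t u)
  fv-appr : ∀ {n} {t u : Tm n} → Free x u → Free x (app t u)

data Value : Term → Set where
  v-var : ∀ x → Value (fvar x)
  v-lam : ∀ t → Value (lam t)

mutual
  data Fireball : Term → Set where
    fb-val   : ∀ {v} → Value v → Fireball v
    fb-inert : ∀ {i} → Inert i → Fireball i

  -- i ::= x f₁ … fₙ  (n > 0)
  data Inert : Term → Set where
    in-var : ∀ x {f} → Fireball f → Inert (app (fvar x) f)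
    in-app : ∀ {i f} → Inert i → Fireball f → Inert (app i f)

-- right evaluation contexts  C ::= ⟨·⟩ | t C | C f
data Ctx : Set where
  hole : Ctx
  appL : Term → Ctx → Ctx
  appR : Ctx → (f : Term) → Fireball f → Ctx

plug : Ctx → Term → Term
plug hole          s = s
plug (appL t C)    s = app t (plug C s)
plug (appR C f _)  s = app (plug C s) f

record Entry : Set where
  constructor [_←_∣_]
  field
    evar  : Var
    eterm : Term
    inert : Inert eterm
open Entry public

-- E ::= ε | [x←i] : E   (ε = [], : = _∷_, E @ [x←i] = E ++ [ [x←i] ])
Env : Set
Env = List Entry

Prog : Set
Prog = Term × Env

data FreeP (y : Var) : Prog → Set where
  fvp-ε  : ∀ {t} → Free y t → FreeP y (t , [])
  fvp-snocl : ∀ {t E e} → FreeP y (t , E) → y ≢ evar e → FreeP y (t , E ++ [ e ])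
  fvp-snocr : ∀ {t E e} → Free y (eterm e) → FreeP y (t , E ++ [ e ])

data InDom (x : Var) : Env → Set where
  here  : ∀ {e E} → evar e ≡ x → InDom x (e ∷ E)
  there : ∀ {e E} → InDom x E → InDom x (e ∷ E)

-- one step of →βf = →βv ∪ →βi.  In βi the bound name x of λx.t is chosen
-- (by α-renaming) fresh for the program and the environment.
data _⟶βf_ : Prog → Prog → Set where
  βv : ∀ (C : Ctx) (t : Tm 1) {v} (E : Env) → Value v →
       (plug C (app (lam t) v) , E) ⟶βf (plug C (open₀ t v) , E)
  βi : ∀ (C : Ctx) (t : Tm 1) {i} (E : Env) (ii : Inert i) (x : Var) →
       ¬ FreeP x (plug C (app (lam t) i) , E) → ¬ InDom x E →
       (plug C (app (lam t) i) , E) ⟶βf (plug C (open₀ t (fvar x)) , [ x ← i ∣ ii ] ∷ E)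

_⟶βf*_ : Prog → Prog → Set
_⟶βf*_ = Star _⟶βf_

Normal : Prog → Set
Normal q = ∀ q' → ¬ (q ⟶βf q')

Terminates : Prog → Set
Terminates p = ∃[ q ] (p ⟶βf* q × Normal q)

-- Multi types.  A multiset is represented by a list; equality of
-- multi types is list permutation up to (recursive) equality of elements.

mutual
  data LType : Set where
    _⊸_ : List LType → List LType → LType

MType : Set
MType = List LType

𝟎 : MType
𝟎 = []

_⊎ₘ_ : MType → MType → MType
_⊎ₘ_ = _++_

mutual
  data _≈L_ : LType → LType → Set where
    ⊸-cong : ∀ {M M' N N'} → M ≈M M' → N ≈M N' → (M ⊸ N) ≈L (M' ⊸ N')

  data _≈M_ : MType → MType → Set where
    []≈   : [] ≈M []
    ∷≈    : ∀ {L L' M N₁ N₂} → L ≈L L' → M ≈M (N₁ ++ N₂) → (L ∷ M) ≈M (N₁ ++ L' ∷ N₂)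

TCtx : Set
TCtx = Var → MType

_⊎ᶜ_ : TCtx → TCtx → TCtx
(Γ ⊎ᶜ Δ) y = Γ y ⊎ₘ Δ y

emptyᶜ : TCtx
emptyᶜ _ = 𝟎

_∶_ : Var → MType → TCtx
(x ∶ M) y with y ≟ x
... | yes _ = M
... | no  _ = 𝟎

-- Γ with x removed: if Γ' = Γ , x : M (x ∉ dom Γ) then Γ = Γ' ∖ x and M = Γ' x
_∖_ : TCtx → Var → TCtx
(Γ ∖ x) y with y ≟ x
... | yes _ = 𝟎
... | no  _ = Γ y

-- Typing rules.  A premise "Γ , x : M ⊢ …" is represented by a premise
-- "Γ' ⊢ …" with Γ = Γ' ∖ x and M = Γ' x.

mutual
  data _⊢_∶_ : TCtx → Term → MType → Set where
    ax  : ∀ x M → (x ∶ M) ⊢ fvar x ∶ M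
    app : ∀ {Γ Δ t u M M' N} → Γ ⊢ t ∶ [ M ⊸ N ] → Δ ⊢ u ∶ M' → M' ≈M M →
          (Γ ⊎ᶜ Δ) ⊢ app t u ∶ N
    lam : ∀ {Γ t M} → LamPremises t Γ M → Γ ⊢ lam t ∶ M

  -- the n ≥ 0 premises Γₖ , x : Mₖ ⊢ t : Nₖ of rule (λ), for λx.t
  data LamPremises (t : Tm 1) : TCtx → MType → Set where
    lp-nil  : LamPremises t emptyᶜ []
    lp-cons : ∀ {Γ' Δ N M} (x : Var) → ¬ Free x (lam t) →
              Γ' ⊢ open₀ t (fvar x) ∶ N → LamPremises t Δ M →
              LamPremises t ((Γ' ∖ x) ⊎ᶜ Δ) ((Γ' x ⊸ N) ∷ M)

data _⊢ₚ_∶_ : TCtx → Prog → MType → Set where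
  es-ε : ∀ {Γ t M} → Γ ⊢ t ∶ M → Γ ⊢ₚ (t , []) ∶ M
  es-snoc : ∀ {Γ' Δ t E N M} (e : Entry) → Γ' ⊢ₚ (t , E) ∶ N →
         Δ ⊢ eterm e ∶ M → M ≈M Γ' (evar e) →
         ((Γ' ∖ evar e) ⊎ᶜ Δ) ⊢ₚ (t , E ++ [ e ]) ∶ N

Typable : Prog → Set
Typable p = ∃[ Γ ] ∃[ M ] (Γ ⊢ₚ p ∶ M)

Suitable : List Var → Prog → Set
Suitable xs p = Unique xs × (∀ y → FreeP y p → y ∈ xs)

ctxOf : (xs : List Var) → Vec MType (length xs) → TCtx
ctxOf []       []       = emptyᶜ
ctxOf (x ∷ xs) (M ∷ Ms) = (x ∶ M) ⊎ᶜ ctxOf xs Ms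

-- ((M₁,…,Mₙ), N) ∈ ⟦p⟧_x⃗  (contexts compared pointwise as multisets)
InSem : (xs : List Var) → Prog → Vec MType (length xs) → MType → Set
InSem xs p Ms N = ∃[ Γ ] ((Γ ⊢ₚ p ∶ N) × (∀ y → Γ y ≈M ctxOf xs Ms y))

SemNonEmpty : List Var → Prog → Set
SemNonEmpty xs p = ∃[ Ms ] ∃[ N ] InSem xs p Ms N

-- Typable programs terminate by quantitative subject reduction. A β_v step
-- substitutes a value whose derivation splits into one piece per occurrence of
-- the variable; a β_i step only renames the bound variable and moves the inert
-- argument into the environment. Either way the number of (@) rules strictly
-- decreases. Conversely, a normal program is a fireball with an environment of
-- inert terms, hence typable (fireballs have type 𝟎 and inert terms have every
-- multi type), and typability goes backwards along β_f by anti-substitution.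
-- Finally, a typing context only uses free variables of the program, which a
-- suitable list contains, so ⟦p⟧ is non-empty exactly when p is typable.

module Submission where

open import Defs
open import Data.Nat using (ℕ; zero; suc; _≤_; _<_; _⊔_; _+_; z≤n; s≤s; _≟_)
import Data.Nat.Properties as ℕP
open import Data.Fin using (Fin; zero; suc)
open import Data.List using (List; []; _∷_; _++_; [_]; length)
import Data.List.Properties as ListP
open import Data.Product using (Σ; _×_; _,_; ∃; proj₁; proj₂)
open import Data.Sum using (_⊎_; inj₁; inj₂)
open import Data.Empty using (⊥-elim)
open import Relation.Nullary using (¬_; yes; no)
open import Function using (case_of_)
open import Relation.Binary.PropositionalEquality hiding ([_])
open import Relation.Binary.Construct.Closure.ReflexiveTransitive using (ε; _◅_)
open import Data.List.Relation.Unary.All as All using (All; []; _∷_)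
open import Data.List.Relation.Binary.Permutation.Propositional as Perm
  using (_↭_; ↭-refl; ↭-sym; ↭-trans; ↭-reflexive; prep; swap)
import Data.List.Relation.Binary.Permutation.Propositional.Properties as PermP
open import Data.List.Relation.Ternary.Interleaving.Propositional
  using (Interleaving; []; consˡ; consʳ; toPermutation)
open import Algebra.Bundles using (CommutativeMonoid)
import Algebra.Properties.CommutativeSemigroup as CommSemigroupProperties
open import Data.Vec using (Vec; []; _∷_)
import Data.List.Relation.Unary.Any as Any
open import Data.List.Membership.Propositional using (_∈_; _∉_)
open import Data.List.Membership.DecPropositional _≟_ using (_∈?_)
open import Data.List.Relation.Unary.Unique.Propositional using (Unique)
open import Data.List.Relation.Unary.AllPairs using (_∷_)
open import Function.Bundles using (_⇔_; mk⇔)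

-- Syntax: substitution, renaming and free names

ren-fuse : ∀ {n m k} (ρ : Fin m → Fin k) (ι : Fin n → Fin m) (ι' : Fin n → Fin k) →
           (∀ i → ρ (ι i) ≡ ι' i) → ∀ t → ren ρ (ren ι t) ≡ ren ι' t
ren-fuse ρ ι ι' h (fvar x)  = refl
ren-fuse ρ ι ι' h (bvar k)  = cong bvar (h k)
ren-fuse ρ ι ι' h (lam t)   = cong lam (ren-fuse _ _ _ (λ { zero → refl ; (suc i) → cong suc (h i) }) t)
ren-fuse ρ ι ι' h (app t u) = cong₂ app (ren-fuse ρ ι ι' h t) (ren-fuse ρ ι ι' h u)

ren-id : ∀ {n} (ρ : Fin n → Fin n) → (∀ i → ρ i ≡ i) → ∀ t → ren ρ t ≡ t
ren-id ρ h (fvar x)  = refl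
ren-id ρ h (bvar k)  = cong bvar (h k)
ren-id ρ h (lam t)   = cong lam (ren-id _ (λ { zero → refl ; (suc i) → cong suc (h i) }) t)
ren-id ρ h (app t u) = cong₂ app (ren-id ρ h t) (ren-id ρ h u)

sub-ren-fuse : ∀ {n m k} (τ : Fin m → Tm k) (ι : Fin n → Fin m) (ι' : Fin n → Fin k) →
               (∀ i → τ (ι i) ≡ bvar (ι' i)) → ∀ t → sub τ (ren ι t) ≡ ren ι' t
sub-ren-fuse τ ι ι' h (fvar x)  = refl
sub-ren-fuse τ ι ι' h (bvar k)  = h k
sub-ren-fuse τ ι ι' h (lam t)   =
  cong lam (sub-ren-fuse _ _ _ (λ { zero → refl ; (suc i) → cong (ren suc) (h i) }) t)
sub-ren-fuse τ ι ι' h (app t u) = cong₂ app (sub-ren-fuse τ ι ι' h t) (sub-ren-fuse τ ι ι' h u)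

sub-cong : ∀ {n m} (σ σ' : Fin n → Tm m) → (∀ i → σ i ≡ σ' i) → ∀ t → sub σ t ≡ sub σ' t
sub-cong σ σ' h (fvar x)  = refl
sub-cong σ σ' h (bvar k)  = h k
sub-cong σ σ' h (lam t)   = cong lam (sub-cong _ _ (λ { zero → refl ; (suc i) → cong (ren suc) (h i) }) t)
sub-cong σ σ' h (app t u) = cong₂ app (sub-cong σ σ' h t) (sub-cong σ σ' h u)

weaken : ∀ {n} → Term → Tm n
weaken v = ren (λ ()) v

ren-weaken : ∀ {n m} (ρ : Fin n → Fin m) v → ren ρ (weaken v) ≡ weaken v
ren-weaken ρ v = ren-fuse ρ (λ ()) (λ ()) (λ ()) v

sub-weaken : ∀ {n m} (τ : Fin n → Tm m) v → sub τ (weaken v) ≡ weaken v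
sub-weaken τ v = sub-ren-fuse τ (λ ()) (λ ()) (λ ()) v

weaken-zero : ∀ v → weaken {0} v ≡ v
weaken-zero v = ren-id (λ ()) (λ ()) v

replace : ∀ {n} → Var → Term → Tm n → Tm n
replace x v (fvar y) with y ≟ x
... | yes _ = weaken v
... | no _  = fvar y
replace x v (bvar k)  = bvar k
replace x v (lam t)   = lam (replace x v t)
replace x v (app t u) = app (replace x v t) (replace x v u)

replace-self : ∀ {n} x v → replace {n} x v (fvar x) ≡ weaken v
replace-self x v with x ≟ x
... | yes _ = refl
... | no x≢x = ⊥-elim (x≢x refl)

replace-other : ∀ {n} x v y → y ≢ x → replace {n} x v (fvar y) ≡ fvar y
replace-other x v y y≢x with y ≟ x
... | yes y≡x = ⊥-elim (y≢x y≡x)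
... | no _    = refl

replace-ren : ∀ {n m} x v (ρ : Fin n → Fin m) t → replace x v (ren ρ t) ≡ ren ρ (replace x v t)
replace-ren x v ρ (fvar y) with y ≟ x
... | yes _ = sym (ren-weaken ρ v)
... | no _  = refl
replace-ren x v ρ (bvar k)  = refl
replace-ren x v ρ (lam t)   = cong lam (replace-ren x v _ t)
replace-ren x v ρ (app t u) = cong₂ app (replace-ren x v ρ t) (replace-ren x v ρ u)

replace-sub : ∀ {n m} x v (σ : Fin n → Tm m) t →
              replace x v (sub σ t) ≡ sub (λ i → replace x v (σ i)) (replace x v t)
replace-sub x v σ (fvar y) with y ≟ x
... | yes _ = sym (sub-weaken _ v)
... | no _  = refl
replace-sub x v σ (bvar k)  = refl
replace-sub x v σ (lam t)   = cong lam (trans (replace-sub x v _ t)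
  (sub-cong _ _ (λ { zero → refl ; (suc i) → replace-ren x v suc (σ i) }) (replace x v t)))
replace-sub x v σ (app t u) = cong₂ app (replace-sub x v σ t) (replace-sub x v σ u)

replace-fresh : ∀ {n} x v (t : Tm n) → ¬ Free x t → replace x v t ≡ t
replace-fresh x v (fvar y) x∉ with y ≟ x
... | yes refl = ⊥-elim (x∉ fv-var)
... | no _     = refl
replace-fresh x v (bvar k)  x∉ = refl
replace-fresh x v (lam t)   x∉ = cong lam (replace-fresh x v t (λ f → x∉ (fv-lam f)))
replace-fresh x v (app t u) x∉ =
  cong₂ app (replace-fresh x v t (λ f → x∉ (fv-appl f))) (replace-fresh x v u (λ f → x∉ (fv-appr f)))

open-replace : ∀ x v (s : Tm 1) → ¬ Free x (lam s) → open₀ s v ≡ replace x v (open₀ s (fvar x))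
open-replace x v s x∉ = sym (trans (replace-sub x v _ s)
  (trans (cong (sub _) (replace-fresh x v s (λ f → x∉ (fv-lam f))))
         (sub-cong _ _ (λ { zero → trans (replace-self x v) (weaken-zero v) }) s)))

replace-open : ∀ x v y (s : Tm 1) → y ≢ x →
               replace x v (open₀ s (fvar y)) ≡ open₀ (replace x v s) (fvar y)
replace-open x v y s y≢x =
  trans (replace-sub x v _ s) (sub-cong _ _ (λ { zero → replace-other x v y y≢x }) (replace x v s))

rename : ∀ {n} → (Var → Var) → Tm n → Tm n
rename π (fvar y)  = fvar (π y)
rename π (bvar k)  = bvar k
rename π (lam t)   = lam (rename π t)
rename π (app t u) = app (rename π t) (rename π u)

rename-ren : ∀ {n m} π (ι : Fin n → Fin m) t → rename π (ren ι t) ≡ ren ι (rename π t)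
rename-ren π ι (fvar x)  = refl
rename-ren π ι (bvar k)  = refl
rename-ren π ι (lam t)   = cong lam (rename-ren π _ t)
rename-ren π ι (app t u) = cong₂ app (rename-ren π ι t) (rename-ren π ι u)

rename-sub : ∀ {n m} π (σ : Fin n → Tm m) t →
             rename π (sub σ t) ≡ sub (λ i → rename π (σ i)) (rename π t)
rename-sub π σ (fvar x)  = refl
rename-sub π σ (bvar k)  = refl
rename-sub π σ (lam t)   = cong lam (trans (rename-sub π _ t)
  (sub-cong _ _ (λ { zero → refl ; (suc i) → rename-ren π suc (σ i) }) (rename π t)))
rename-sub π σ (app t u) = cong₂ app (rename-sub π σ t) (rename-sub π σ u)

rename-open : ∀ π (s : Tm 1) z → rename π (open₀ s (fvar z)) ≡ open₀ (rename π s) (fvar (π z))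
rename-open π s z = trans (rename-sub π _ s) (sub-cong _ _ (λ { zero → refl }) (rename π s))

rename-fresh : ∀ {n} π (t : Tm n) → (∀ y → Free y t → π y ≡ y) → rename π t ≡ t
rename-fresh π (fvar x)  h = cong fvar (h x fv-var)
rename-fresh π (bvar k)  h = refl
rename-fresh π (lam t)   h = cong lam (rename-fresh π t (λ y f → h y (fv-lam f)))
rename-fresh π (app t u) h =
  cong₂ app (rename-fresh π t (λ y f → h y (fv-appl f))) (rename-fresh π u (λ y f → h y (fv-appr f)))

Free-rename⁻ : ∀ {n} π (t : Tm n) {y} → Free y (rename π t) → ∃ λ y' → π y' ≡ y × Free y' t
Free-rename⁻ π (fvar x) fv-var = x , refl , fv-var
Free-rename⁻ π (lam t) (fv-lam f) with Free-rename⁻ π t f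
... | y' , e , g = y' , e , fv-lam g
Free-rename⁻ π (app t u) (fv-appl f) with Free-rename⁻ π t f
... | y' , e , g = y' , e , fv-appl g
Free-rename⁻ π (app t u) (fv-appr f) with Free-rename⁻ π u f
... | y' , e , g = y' , e , fv-appr g

Free-ren⁻ : ∀ {n m} (ρ : Fin n → Fin m) t {y} → Free y (ren ρ t) → Free y t
Free-ren⁻ ρ (fvar x)  fv-var      = fv-var
Free-ren⁻ ρ (lam t)   (fv-lam f)  = fv-lam (Free-ren⁻ _ t f)
Free-ren⁻ ρ (app t u) (fv-appl f) = fv-appl (Free-ren⁻ ρ t f)
Free-ren⁻ ρ (app t u) (fv-appr f) = fv-appr (Free-ren⁻ ρ u f)

Free-sub⁻ : ∀ {n m} (σ : Fin n → Tm m) t {y} → Free y (sub σ t) → Free y t ⊎ ∃ λ i → Free y (σ i)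
Free-sub⁻ σ (fvar x) fv-var = inj₁ fv-var
Free-sub⁻ σ (bvar k) f      = inj₂ (k , f)
Free-sub⁻ σ (lam t) (fv-lam f) with Free-sub⁻ _ t f
... | inj₁ g             = inj₁ (fv-lam g)
... | inj₂ (zero , ())
... | inj₂ (suc i , g)   = inj₂ (i , Free-ren⁻ suc (σ i) g)
Free-sub⁻ σ (app t u) (fv-appl f) with Free-sub⁻ σ t f
... | inj₁ g = inj₁ (fv-appl g)
... | inj₂ g = inj₂ g
Free-sub⁻ σ (app t u) (fv-appr f) with Free-sub⁻ σ u f
... | inj₁ g = inj₁ (fv-appr g)
... | inj₂ g = inj₂ g

Free-open⁻ : ∀ (s : Tm 1) a {y} → Free y (open₀ s a) → Free y (lam s) ⊎ Free y a
Free-open⁻ s a f with Free-sub⁻ _ s f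
... | inj₁ g        = inj₁ (fv-lam g)
... | inj₂ (zero , g) = inj₂ g

Free-replace⁻ : ∀ {n} x v (t : Tm n) {y} → Free y (replace x v t) → (Free y t × y ≢ x) ⊎ Free y v
Free-replace⁻ x v (fvar z) f with z ≟ x
Free-replace⁻ x v (fvar z) f      | yes _   = inj₂ (Free-ren⁻ _ v f)
Free-replace⁻ x v (fvar z) fv-var | no z≢x = inj₁ (fv-var , z≢x)
Free-replace⁻ x v (lam t) (fv-lam f) with Free-replace⁻ x v t f
... | inj₁ (g , y≢x) = inj₁ (fv-lam g , y≢x)
... | inj₂ g         = inj₂ g
Free-replace⁻ x v (app t u) (fv-appl f) with Free-replace⁻ x v t f
... | inj₁ (g , y≢x) = inj₁ (fv-appl g , y≢x)
... | inj₂ g         = inj₂ g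
Free-replace⁻ x v (app t u) (fv-appr f) with Free-replace⁻ x v u f
... | inj₁ (g , y≢x) = inj₁ (fv-appr g , y≢x)
... | inj₂ g         = inj₂ g

Free-plug⁺ : ∀ C {a y} → Free y a → Free y (plug C a)
Free-plug⁺ hole         f = f
Free-plug⁺ (appL t C)   f = fv-appr (Free-plug⁺ C f)
Free-plug⁺ (appR C g _) f = fv-appl (Free-plug⁺ C f)

¬Free-fvar : ∀ {w x} → ¬ Free w {0} (fvar x) → w ≢ x
¬Free-fvar w∉x refl = w∉x fv-var

maxFree : ∀ {n} → Tm n → ℕ
maxFree (fvar y)  = y
maxFree (bvar _)  = 0
maxFree (lam t)   = maxFree t
maxFree (app t u) = maxFree t ⊔ maxFree u

Free⇒≤maxFree : ∀ {n} (t : Tm n) {y} → Free y t → y ≤ maxFree t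
Free⇒≤maxFree (fvar y)  fv-var      = ℕP.≤-refl
Free⇒≤maxFree (lam t)   (fv-lam f)  = Free⇒≤maxFree t f
Free⇒≤maxFree (app t u) (fv-appl f) = ℕP.≤-trans (Free⇒≤maxFree t f) (ℕP.m≤m⊔n _ _)
Free⇒≤maxFree (app t u) (fv-appr f) = ℕP.≤-trans (Free⇒≤maxFree u f) (ℕP.m≤n⊔m _ _)

¬Free-above : ∀ {n} (t : Tm n) {m} → maxFree t ≤ m → ¬ Free (suc m) t
¬Free-above t t≤m f = ℕP.<-irrefl refl (s≤s (ℕP.≤-trans (Free⇒≤maxFree t f) t≤m))

maxFree* : List Term → ℕ
maxFree* []       = 0
maxFree* (t ∷ ts) = maxFree t ⊔ maxFree* ts

fresh : (ts : List Term) → ∃ λ w → All (λ t → ¬ Free w t) ts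
fresh ts = suc (maxFree* ts) , above ts ℕP.≤-refl
  where
    above : ∀ {m} ts → maxFree* ts ≤ m → All (λ t → ¬ Free (suc m) t) ts
    above []       _  = []
    above (t ∷ ts) ≤m = ¬Free-above t (ℕP.≤-trans (ℕP.m≤m⊔n _ _) ≤m)
                      ∷ above ts (ℕP.≤-trans (ℕP.m≤n⊔m (maxFree t) _) ≤m)

transpose : Var → Var → Var → Var
transpose a b y with y ≟ a
... | yes _ = b
... | no _ with y ≟ b
... | yes _ = a
... | no _  = y

transpose-left : ∀ a b → transpose a b a ≡ b
transpose-left a b with a ≟ a
... | yes _ = refl
... | no a≢a = ⊥-elim (a≢a refl)

transpose-right : ∀ a b → transpose a b b ≡ a
transpose-right a b with b ≟ a
... | yes b≡a = b≡a
... | no _ with b ≟ b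
... | yes _ = refl
... | no b≢b = ⊥-elim (b≢b refl)

transpose-other : ∀ a b y → y ≢ a → y ≢ b → transpose a b y ≡ y
transpose-other a b y y≢a y≢b with y ≟ a
... | yes y≡a = ⊥-elim (y≢a y≡a)
... | no _ with y ≟ b
... | yes y≡b = ⊥-elim (y≢b y≡b)
... | no _    = refl

transpose-involutive : ∀ a b y → transpose a b (transpose a b y) ≡ y
transpose-involutive a b y with y ≟ a
transpose-involutive a b y | yes refl = transpose-right a b
transpose-involutive a b y | no y≢a with y ≟ b
transpose-involutive a b y | no y≢a | yes refl = transpose-left a b
transpose-involutive a b y | no y≢a | no y≢b   = transpose-other a b y y≢a y≢b

-- Type contexts and multiset equivalence

++-conical : ∀ {A : Set} (xs ys : List A) → xs ++ ys ≡ [] → xs ≡ [] × ys ≡ []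
++-conical xs ys e = ListP.++-conicalˡ xs ys e , ListP.++-conicalʳ xs ys e

∶-self : ∀ x M → (x ∶ M) x ≡ M
∶-self x M with x ≟ x
... | yes _  = refl
... | no x≢x = ⊥-elim (x≢x refl)

∶-other : ∀ x M y → y ≢ x → (x ∶ M) y ≡ []
∶-other x M y y≢x with y ≟ x
... | yes y≡x = ⊥-elim (y≢x y≡x)
... | no _    = refl

∶-[] : ∀ x y → (x ∶ []) y ≡ []
∶-[] x y with y ≟ x
... | yes _ = refl
... | no _  = refl

∖-self : ∀ Γ x → (Γ ∖ x) x ≡ []
∖-self Γ x with x ≟ x
... | yes _  = refl
... | no x≢x = ⊥-elim (x≢x refl)

∖-other : ∀ Γ x y → y ≢ x → (Γ ∖ x) y ≡ Γ y
∖-other Γ x y y≢x with y ≟ x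
... | yes y≡x = ⊥-elim (y≢x y≡x)
... | no _    = refl

∖-view : ∀ Γ x y → (y ≡ x × (Γ ∖ x) y ≡ []) ⊎ (y ≢ x × (Γ ∖ x) y ≡ Γ y)
∖-view Γ x y with y ≟ x
... | yes y≡x = inj₁ (y≡x , refl)
... | no y≢x  = inj₂ (y≢x , refl)

∖-unbound : ∀ Γ x y → Γ x ≡ [] → (Γ ∖ x) y ≡ Γ y
∖-unbound Γ x y Γx≡[] with y ≟ x
... | yes refl = sym Γx≡[]
... | no _     = refl

∖-agree : ∀ (Γ Γ' : TCtx) x y → (y ≢ x → Γ' y ≡ Γ y) → (Γ' ∖ x) y ≡ (Γ ∖ x) y
∖-agree Γ Γ' x y h with y ≟ x
... | yes _   = refl
... | no y≢x  = h y≢x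

∖-⊎ᶜ : ∀ Γ Δ x y → ((Γ ⊎ᶜ Δ) ∖ x) y ≡ (Γ ∖ x) y ++ (Δ ∖ x) y
∖-⊎ᶜ Γ Δ x y with y ≟ x
... | yes _ = refl
... | no _  = refl

∶-∖-self : ∀ x M y → ((x ∶ M) ∖ x) y ≡ []
∶-∖-self x M y with y ≟ x
... | yes _   = refl
... | no y≢x  = ∶-other x M y y≢x

emptyᶜ-∖ : ∀ x y → (emptyᶜ ∖ x) y ≡ []
emptyᶜ-∖ x y with y ≟ x
... | yes _ = refl
... | no _  = refl

∖-↭ : ∀ Γ Γ' x → (∀ y → Γ y ↭ Γ' y) → ∀ y → (Γ ∖ x) y ↭ (Γ' ∖ x) y
∖-↭ Γ Γ' x h y with y ≟ x
... | yes _ = ↭-refl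
... | no _  = h y

module _ (π : Var → Var) (π-involutive : ∀ y → π (π y) ≡ y) where

  ∶-rename : ∀ x M y → (π x ∶ M) y ≡ (x ∶ M) (π y)
  ∶-rename x M y with y ≟ π x | π y ≟ x
  ... | yes _   | yes _   = refl
  ... | yes y≡  | no πy≢  = ⊥-elim (πy≢ (trans (cong π y≡) (π-involutive x)))
  ... | no y≢   | yes πy≡ = ⊥-elim (y≢ (trans (sym (π-involutive y)) (cong π πy≡)))
  ... | no _    | no _    = refl

  ∖-rename : ∀ (Γ Γ' : TCtx) → (∀ y → Γ' y ≡ Γ (π y)) → ∀ z y → (Γ' ∖ π z) y ≡ (Γ ∖ z) (π y)
  ∖-rename Γ Γ' h z y with y ≟ π z | π y ≟ z
  ... | yes _   | yes _   = refl
  ... | yes y≡  | no πy≢  = ⊥-elim (πy≢ (trans (cong π y≡) (π-involutive z)))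
  ... | no y≢   | yes πy≡ = ⊥-elim (y≢ (trans (sym (π-involutive y)) (cong π πy≡)))
  ... | no _    | no _    = h y

module ++-Interchange = CommSemigroupProperties
  (CommutativeMonoid.commutativeSemigroup (PermP.++-commutativeMonoid {A = LType}))

↭-interchange : ∀ (a₁ a₂ : MType) {p q b₁ b₂ d} →
  p ↭ a₁ ++ b₁ → q ↭ a₂ ++ b₂ → d ↭ b₁ ++ b₂ → p ++ q ↭ (a₁ ++ a₂) ++ d
↭-interchange a₁ a₂ {b₁ = b₁} {b₂} p↭ q↭ d↭ = ↭-trans (PermP.++⁺ p↭ q↭)
  (↭-trans (++-Interchange.interchange a₁ b₁ a₂ b₂) (PermP.++⁺ˡ (a₁ ++ a₂) (↭-sym d↭)))

mutual
  ≈L-refl : ∀ L → L ≈L L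
  ≈L-refl (M ⊸ N) = ⊸-cong (≈M-refl M) (≈M-refl N)

  ≈M-refl : ∀ M → M ≈M M
  ≈M-refl []      = []≈
  ≈M-refl (L ∷ M) = ∷≈ {N₁ = []} (≈L-refl L) (≈M-refl M)

≈M-∷ : ∀ {L L' M M'} → L ≈L L' → M ≈M M' → (L ∷ M) ≈M (L' ∷ M')
≈M-∷ = ∷≈ {N₁ = []}

++-split-∷ : ∀ {A : Set} (D₁ D₂ E₁ : List A) c E₂ → D₁ ++ D₂ ≡ E₁ ++ c ∷ E₂ →
  (∃ λ F → D₁ ≡ E₁ ++ c ∷ F × E₂ ≡ F ++ D₂) ⊎ (∃ λ G → D₂ ≡ G ++ c ∷ E₂ × E₁ ≡ D₁ ++ G)
++-split-∷ [] D₂ E₁ c E₂ eq = inj₂ (E₁ , eq , refl)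
++-split-∷ (d ∷ D₁) D₂ [] c E₂ eq with ListP.∷-injective eq
... | refl , eq' = inj₁ (D₁ , refl , sym eq')
++-split-∷ (d ∷ D₁) D₂ (e ∷ E₁) c E₂ eq with ListP.∷-injective eq
... | refl , eq' with ++-split-∷ D₁ D₂ E₁ c E₂ eq'
... | inj₁ (F , p , q) = inj₁ (F , cong (d ∷_) p , q)
... | inj₂ (G , p , q) = inj₂ (G , p , cong (d ∷_) q)

≈M-locate : ∀ {B C} → B ≈M C → ∀ B₁ b B₂ → B ≡ B₁ ++ b ∷ B₂ →
  ∃ λ C₁ → ∃ λ c → ∃ λ C₂ → C ≡ C₁ ++ c ∷ C₂ × b ≈L c × (B₁ ++ B₂) ≈M (C₁ ++ C₂)
≈M-locate []≈ [] b B₂ ()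
≈M-locate []≈ (_ ∷ _) b B₂ ()
≈M-locate (∷≈ {N₁ = N₁} {N₂} l m) [] b B₂ eq with ListP.∷-injective eq
... | refl , refl = N₁ , _ , N₂ , refl , l , m
≈M-locate (∷≈ {L' = L'} {N₁ = N₁} {N₂} l m) (k ∷ B₁) b B₂ eq with ListP.∷-injective eq
... | refl , eq' with ≈M-locate m B₁ b B₂ eq'
... | E₁ , c , E₂ , e , b≈c , m' with ++-split-∷ N₁ N₂ E₁ c E₂ e
... | inj₁ (F , refl , refl) =
  E₁ , c , F ++ L' ∷ N₂ , ListP.++-assoc E₁ (c ∷ F) (L' ∷ N₂) , b≈c ,
  subst (_ ≈M_) (ListP.++-assoc E₁ F (L' ∷ N₂))
    (∷≈ {N₁ = E₁ ++ F} {N₂} l (subst (_ ≈M_) (sym (ListP.++-assoc E₁ F N₂)) m'))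
... | inj₂ (G , refl , refl) =
  N₁ ++ L' ∷ G , c , E₂ , sym (ListP.++-assoc N₁ (L' ∷ G) (c ∷ E₂)) , b≈c ,
  subst (_ ≈M_) (sym (ListP.++-assoc N₁ (L' ∷ G) E₂))
    (∷≈ {N₁ = N₁} {G ++ E₂} l (subst (_ ≈M_) (ListP.++-assoc N₁ G E₂) m'))

mutual
  ≈L-trans : ∀ {A B C} → A ≈L B → B ≈L C → A ≈L C
  ≈L-trans (⊸-cong a b) (⊸-cong c d) = ⊸-cong (≈M-trans a c) (≈M-trans b d)

  ≈M-trans : ∀ {A B C} → A ≈M B → B ≈M C → A ≈M C
  ≈M-trans []≈ q = q
  ≈M-trans (∷≈ {N₁ = N₁} {N₂} l m) q with ≈M-locate q N₁ _ N₂ refl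
  ... | C₁ , c , C₂ , refl , l' , m' = ∷≈ (≈L-trans l l') (≈M-trans m m')

≈M-insert : ∀ A₁ {a A₂ b B} → (A₁ ++ A₂) ≈M B → a ≈L b → (A₁ ++ a ∷ A₂) ≈M (b ∷ B)
≈M-insert []       m l = ≈M-∷ l m
≈M-insert (k ∷ A₁) {b = b} (∷≈ {N₁ = D₁} l' m) l = ∷≈ {N₁ = b ∷ D₁} l' (≈M-insert A₁ m l)

mutual
  ≈L-sym : ∀ {A B} → A ≈L B → B ≈L A
  ≈L-sym (⊸-cong a b) = ⊸-cong (≈M-sym a) (≈M-sym b)

  ≈M-sym : ∀ {A B} → A ≈M B → B ≈M A
  ≈M-sym []≈                 = []≈
  ≈M-sym (∷≈ {N₁ = N₁} l m) = ≈M-insert N₁ (≈M-sym m) (≈L-sym l)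

↭⇒≈M : ∀ {A B} → A ↭ B → A ≈M B
↭⇒≈M Perm.refl        = ≈M-refl _
↭⇒≈M (prep x p)       = ≈M-∷ (≈L-refl x) (↭⇒≈M p)
↭⇒≈M (swap x y p)     = ∷≈ {N₁ = [ y ]} (≈L-refl x) (≈M-∷ (≈L-refl y) (↭⇒≈M p))
↭⇒≈M (Perm.trans p q) = ≈M-trans (↭⇒≈M p) (↭⇒≈M q)

≈M-[]⁻ : ∀ {K T} → K ≈M T → T ≡ [] → K ≡ []
≈M-[]⁻ []≈                    _  = refl
≈M-[]⁻ (∷≈ {N₁ = []} l m)    ()
≈M-[]⁻ (∷≈ {N₁ = _ ∷ _} l m) ()

≈M-[-]⁻ : ∀ {K T A} → K ≈M T → T ≡ [ A ] → ∃ λ B → K ≡ [ B ] × B ≈L A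
≈M-[-]⁻ (∷≈ {N₁ = []} l m) e with ListP.∷-injective e
... | refl , refl with ≈M-[]⁻ m refl
... | refl = _ , refl , l
≈M-[-]⁻ (∷≈ {N₁ = _ ∷ []} l m)    ()
≈M-[-]⁻ (∷≈ {N₁ = _ ∷ _ ∷ _} l m) ()

≈M-split : ∀ {K T} → K ≈M T → ∀ A B → T ≡ A ++ B →
  ∃ λ K₁ → ∃ λ K₂ → Interleaving K₁ K₂ K × K₁ ≈M A × K₂ ≈M B
≈M-split []≈ A B e with ++-conical A B (sym e)
... | refl , refl = [] , [] , [] , []≈ , []≈
≈M-split (∷≈ {L' = L'} {N₁ = N₁} {N₂} l m) A B e with ++-split-∷ A B N₁ L' N₂ (sym e)
... | inj₁ (F , refl , refl) with ≈M-split m (N₁ ++ F) B (sym (ListP.++-assoc N₁ F B))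
...   | K₁ , K₂ , i , p , q = _ ∷ K₁ , K₂ , consˡ i , ∷≈ l p , q
≈M-split (∷≈ {L' = L'} {N₁ = N₁} {N₂} l m) A B e | inj₂ (G , refl , refl)
  with ≈M-split m A (G ++ N₂) (ListP.++-assoc A G N₂)
... | K₁ , K₂ , i , p , q = K₁ , _ ∷ K₂ , consʳ i , p , ∷≈ l q

-- Type derivations

-- size counts only the (@) rules: each β_f step removes the one of its redex,
-- so it bounds the length of evaluation.
mutual
  size : ∀ {Γ t M} → Γ ⊢ t ∶ M → ℕ
  size (ax _ _)    = 0
  size (app D E _) = suc (size D + size E)
  size (lam lp)    = sizeLP lp

  sizeLP : ∀ {t Γ M} → LamPremises t Γ M → ℕ
  sizeLP lp-nil              = 0
  sizeLP (lp-cons _ _ D lp) = size D + sizeLP lp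

-- nodes counts every rule; it is the induction measure of lemmas that rebuild
-- premises after renaming their bound name, which is not a structural descent.
mutual
  nodes : ∀ {Γ t M} → Γ ⊢ t ∶ M → ℕ
  nodes (ax _ _)    = 0
  nodes (app D E _) = suc (nodes D + nodes E)
  nodes (lam lp)    = suc (nodesLP lp)

  nodesLP : ∀ {t Γ M} → LamPremises t Γ M → ℕ
  nodesLP lp-nil              = 0
  nodesLP (lp-cons _ _ D lp) = suc (nodes D + nodesLP lp)

⊢-cast : ∀ {Γ t t' N} → t ≡ t' → Γ ⊢ t ∶ N → Γ ⊢ t' ∶ N
⊢-cast refl D = D

⊢-castType : ∀ {Γ t N N'} → N ≡ N' → Γ ⊢ t ∶ N → Γ ⊢ t ∶ N'
⊢-castType refl D = D

size-⊢-cast : ∀ {Γ t t' N} (e : t ≡ t') (D : Γ ⊢ t ∶ N) → size (⊢-cast e D) ≡ size D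
size-⊢-cast refl D = refl

nodes-⊢-cast : ∀ {Γ t t' N} (e : t ≡ t') (D : Γ ⊢ t ∶ N) → nodes (⊢-cast e D) ≡ nodes D
nodes-⊢-cast refl D = refl

lp-cons′ : ∀ {s Γ' Δ N M A} (z : Var) → ¬ Free z (lam s) → (P : Γ' ⊢ open₀ s (fvar z) ∶ N) →
           LamPremises s Δ M → Γ' z ≡ A → LamPremises s ((Γ' ∖ z) ⊎ᶜ Δ) ((A ⊸ N) ∷ M)
lp-cons′ z z∉ P lp refl = lp-cons z z∉ P lp

sizeLP-lp-cons′ : ∀ {s Γ' Δ N M A} z z∉ (P : Γ' ⊢ open₀ s (fvar z) ∶ N) (lp : LamPremises s Δ M)
                  (e : Γ' z ≡ A) → sizeLP (lp-cons′ z z∉ P lp e) ≡ size P + sizeLP lp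
sizeLP-lp-cons′ z z∉ P lp refl = refl

nodesLP-lp-cons′ : ∀ {s Γ' Δ N M A} z z∉ (P : Γ' ⊢ open₀ s (fvar z) ∶ N) (lp : LamPremises s Δ M)
                   (e : Γ' z ≡ A) → nodesLP (lp-cons′ z z∉ P lp e) ≡ suc (nodes P + nodesLP lp)
nodesLP-lp-cons′ z z∉ P lp refl = refl

value-typable-[] : ∀ {v} → Value v → ∃ λ Δ → Δ ⊢ v ∶ []
value-typable-[] (v-var w) = (w ∶ []) , ax w []
value-typable-[] (v-lam s) = emptyᶜ , lam lp-nil

value-[]⁻ : ∀ {v Δ} → Value v → Δ ⊢ v ∶ [] → ∀ y → Δ y ≡ []
value-[]⁻ (v-var w) (ax .w .[])   = ∶-[] w
value-[]⁻ (v-lam s) (lam lp-nil) = λ _ → refl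

mutual
  inert-typable : ∀ {i} → Inert i → ∀ M → ∃ λ Γ → Γ ⊢ i ∶ M
  inert-typable (in-var x f) M = _ , app (ax x [ [] ⊸ M ]) (proj₂ (fireball-typable-[] f)) []≈
  inert-typable (in-app i f) M =
    _ , app (proj₂ (inert-typable i [ [] ⊸ M ])) (proj₂ (fireball-typable-[] f)) []≈

  fireball-typable-[] : ∀ {f} → Fireball f → ∃ λ Γ → Γ ⊢ f ∶ []
  fireball-typable-[] (fb-val v)   = value-typable-[] v
  fireball-typable-[] (fb-inert i) = inert-typable i []

++-≢[] : ∀ {A : Set} (xs ys : List A) → xs ++ ys ≢ [] → xs ≢ [] ⊎ ys ≢ []
++-≢[] []      ys h = inj₂ h
++-≢[] (x ∷ xs) ys h = inj₁ (λ ())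

¬≢[]⇒≡[] : ∀ {A : Set} (xs : List A) → ¬ xs ≢ [] → xs ≡ []
¬≢[]⇒≡[] []       _ = refl
¬≢[]⇒≡[] (x ∷ xs) h = ⊥-elim (h (λ ()))

mutual
  typed⇒Free : ∀ {Γ t N} → Γ ⊢ t ∶ N → ∀ y → Γ y ≢ [] → Free y t
  typed⇒Free (ax x M) y h with y ≟ x
  ... | yes refl = fv-var
  ... | no _     = ⊥-elim (h refl)
  typed⇒Free (app {Γ = Γ} {Δ} D E _) y h with ++-≢[] (Γ y) (Δ y) h
  ... | inj₁ g = fv-appl (typed⇒Free D y g)
  ... | inj₂ g = fv-appr (typed⇒Free E y g)
  typed⇒Free (lam lp) y h = typedLP⇒Free lp y h

  typedLP⇒Free : ∀ {s Γ M} → LamPremises s Γ M → ∀ y → Γ y ≢ [] → Free y (lam s)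
  typedLP⇒Free lp-nil y h = ⊥-elim (h refl)
  typedLP⇒Free (lp-cons {Γ' = Γ'} {Δ} z z∉ P lp) y h with ++-≢[] ((Γ' ∖ z) y) (Δ y) h
  ... | inj₂ g = typedLP⇒Free lp y g
  ... | inj₁ g with ∖-view Γ' z y
  ...   | inj₁ (_ , e) = ⊥-elim (g e)
  ...   | inj₂ (y≢z , e) with Free-open⁻ _ _ (typed⇒Free P y (λ e' → g (trans e e')))
  ...     | inj₁ f      = f
  ...     | inj₂ fv-var = ⊥-elim (y≢z refl)

¬Free⇒unused : ∀ {Γ t N} → Γ ⊢ t ∶ N → ∀ {y} → ¬ Free y t → Γ y ≡ []
¬Free⇒unused {Γ} D {y} y∉ = ¬≢[]⇒≡[] (Γ y) (λ h → y∉ (typed⇒Free D y h))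

-- Renaming free names in derivations

record Renamed (π : Var → Var) {Γ t N} (D : Γ ⊢ t ∶ N) : Set where
  field
    Γ'     : TCtx
    D'     : Γ' ⊢ rename π t ∶ N
    ctx    : ∀ y → Γ' y ≡ Γ (π y)
    nodes≡ : nodes D' ≡ nodes D
    size≡  : size D' ≡ size D

record RenamedLP (π : Var → Var) {s Γ M} (lp : LamPremises s Γ M) : Set where
  field
    Γ'     : TCtx
    lp'    : LamPremises (rename π s) Γ' M
    ctx    : ∀ y → Γ' y ≡ Γ (π y)
    nodes≡ : nodesLP lp' ≡ nodesLP lp
    size≡  : sizeLP lp' ≡ sizeLP lp

module _ (π : Var → Var) (π-involutive : ∀ y → π (π y) ≡ y) where

  private
    π-injective : ∀ {a b} → π a ≡ π b → a ≡ b
    π-injective {a} {b} e = trans (sym (π-involutive a)) (trans (cong π e) (π-involutive b))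

  mutual
    rename-⊢ : ∀ {Γ t N} (D : Γ ⊢ t ∶ N) → Renamed π D
    rename-⊢ (ax x M) = record
      { Γ' = π x ∶ M ; D' = ax (π x) M ; ctx = ∶-rename π π-involutive x M
      ; nodes≡ = refl ; size≡ = refl }
    rename-⊢ (app D E eq) = record
      { Γ'     = Renamed.Γ' r ⊎ᶜ Renamed.Γ' q
      ; D'     = app (Renamed.D' r) (Renamed.D' q) eq
      ; ctx    = λ y → cong₂ _++_ (Renamed.ctx r y) (Renamed.ctx q y)
      ; nodes≡ = cong suc (cong₂ _+_ (Renamed.nodes≡ r) (Renamed.nodes≡ q))
      ; size≡  = cong suc (cong₂ _+_ (Renamed.size≡ r) (Renamed.size≡ q)) }
      where r : Renamed π D
            r = rename-⊢ D
            q : Renamed π E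
            q = rename-⊢ E
    rename-⊢ (lam lp) = record
      { Γ' = RenamedLP.Γ' r ; D' = lam (RenamedLP.lp' r) ; ctx = RenamedLP.ctx r
      ; nodes≡ = cong suc (RenamedLP.nodes≡ r) ; size≡ = RenamedLP.size≡ r }
      where r : RenamedLP π lp
            r = rename-lp lp

    rename-lp : ∀ {s Γ M} (lp : LamPremises s Γ M) → RenamedLP π lp
    rename-lp lp-nil = record
      { Γ' = emptyᶜ ; lp' = lp-nil ; ctx = λ _ → refl ; nodes≡ = refl ; size≡ = refl }
    rename-lp {s} (lp-cons {Γ' = Γ} {N = N} z z∉ P lp) = record
      { Γ'     = (Renamed.Γ' r ∖ π z) ⊎ᶜ RenamedLP.Γ' q
      ; lp'    = lp-cons′ (π z) πz∉ P' (RenamedLP.lp' q) at-πz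
      ; ctx    = λ y → cong₂ _++_ (∖-rename π π-involutive Γ (Renamed.Γ' r) (Renamed.ctx r) z y)
                                  (RenamedLP.ctx q y)
      ; nodes≡ = trans (nodesLP-lp-cons′ (π z) πz∉ P' (RenamedLP.lp' q) at-πz)
                   (cong suc (cong₂ _+_ (trans (nodes-⊢-cast (rename-open π s z) (Renamed.D' r))
                                               (Renamed.nodes≡ r))
                                        (RenamedLP.nodes≡ q)))
      ; size≡  = trans (sizeLP-lp-cons′ (π z) πz∉ P' (RenamedLP.lp' q) at-πz)
                   (cong₂ _+_ (trans (size-⊢-cast (rename-open π s z) (Renamed.D' r)) (Renamed.size≡ r))
                              (RenamedLP.size≡ q)) }
      where
        r : Renamed π P
        r = rename-⊢ P
        q : RenamedLP π lp
        q = rename-lp lp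
        P' : Renamed.Γ' r ⊢ open₀ (rename π s) (fvar (π z)) ∶ N
        P' = ⊢-cast (rename-open π s z) (Renamed.D' r)
        at-πz : Renamed.Γ' r (π z) ≡ Γ z
        at-πz = trans (Renamed.ctx r (π z)) (cong Γ (π-involutive z))
        πz∉ : ¬ Free (π z) (lam (rename π s))
        πz∉ f with Free-rename⁻ π (lam s) f
        ... | y , e , g with π-injective e
        ...   | refl = z∉ g

record Rebound (s : Tm 1) {z Γ N} (P : Γ ⊢ open₀ s (fvar z) ∶ N) (w : Var) : Set where
  field
    Γ'        : TCtx
    D         : Γ' ⊢ open₀ s (fvar w) ∶ N
    at-bound  : Γ' w ≡ Γ z
    off-bound : ∀ y → (Γ' ∖ w) y ≡ (Γ ∖ z) y
    nodes≡    : nodes D ≡ nodes P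
    size≡     : size D ≡ size P

rebind : ∀ {s z Γ N} (P : Γ ⊢ open₀ s (fvar z) ∶ N) → ¬ Free z (lam s) →
         ∀ {w} → ¬ Free w (lam s) → Rebound s P w
rebind {s} {z} {Γ} P z∉ {w} w∉ = record
  { Γ' = Γ' ; D = ⊢-cast term≡ (Renamed.D' r)
  ; at-bound  = trans (Renamed.ctx r w) (cong Γ (transpose-right z w))
  ; off-bound = off-bound
  ; nodes≡ = trans (nodes-⊢-cast term≡ (Renamed.D' r)) (Renamed.nodes≡ r)
  ; size≡  = trans (size-⊢-cast term≡ (Renamed.D' r)) (Renamed.size≡ r) }
  where
    r : Renamed (transpose z w) P
    r = rename-⊢ (transpose z w) (transpose-involutive z w) P
    Γ' : TCtx
    Γ' = Renamed.Γ' r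
    fixes-s : ∀ y → Free y s → transpose z w y ≡ y
    fixes-s y f = transpose-other z w y (λ { refl → z∉ (fv-lam f) }) (λ { refl → w∉ (fv-lam f) })
    term≡ : rename (transpose z w) (open₀ s (fvar z)) ≡ open₀ s (fvar w)
    term≡ = trans (rename-open (transpose z w) s z)
                  (cong₂ open₀ (rename-fresh (transpose z w) s fixes-s) (cong fvar (transpose-left z w)))
    Γw≡[] : w ≢ z → Γ w ≡ []
    Γw≡[] w≢z = ¬Free⇒unused P λ f → case Free-open⁻ s (fvar z) f of λ
      { (inj₁ g) → w∉ g ; (inj₂ fv-var) → w≢z refl }
    off-bound : ∀ y → (Γ' ∖ w) y ≡ (Γ ∖ z) y
    off-bound y with ∖-view Γ' w y | ∖-view Γ z y
    ... | inj₁ (refl , e) | inj₁ (_ , e')    = trans e (sym e')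
    ... | inj₁ (refl , e) | inj₂ (y≢z , e')  = trans e (sym (trans e' (Γw≡[] y≢z)))
    ... | inj₂ (y≢w , e)  | inj₁ (refl , e') =
          trans e (trans (Renamed.ctx r y) (trans (cong Γ (transpose-left y w))
                  (trans (Γw≡[] (λ { refl → y≢w refl })) (sym e'))))
    ... | inj₂ (y≢w , e)  | inj₂ (y≢z , e')  =
          trans e (trans (Renamed.ctx r y) (trans (cong Γ (transpose-other z w y y≢z y≢w)) (sym e')))

-- Substitution and anti-substitution of values

module +-Interchange = CommSemigroupProperties ℕP.+-commutativeSemigroup

+-interchange-≤ : ∀ a b s₁ s₂ {s a' b'} → a' ≤ a + s₁ → b' ≤ b + s₂ → s₁ + s₂ ≡ s → a' + b' ≤ (a + b) + s
+-interchange-≤ a b s₁ s₂ a'≤ b'≤ refl =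
  ℕP.≤-trans (ℕP.+-mono-≤ a'≤ b'≤) (ℕP.≤-reflexive (+-Interchange.interchange a s₁ b s₂))

record LPSplit {s Δ K} (lp : LamPremises s Δ K) (K₁ K₂ : MType) : Set where
  field
    Δ₁ Δ₂ : TCtx
    lp₁   : LamPremises s Δ₁ K₁
    lp₂   : LamPremises s Δ₂ K₂
    ctx   : ∀ y → Δ y ↭ Δ₁ y ++ Δ₂ y
    size≡ : sizeLP lp₁ + sizeLP lp₂ ≡ sizeLP lp

split-lp : ∀ {s Δ K K₁ K₂} (lp : LamPremises s Δ K) → Interleaving K₁ K₂ K → LPSplit lp K₁ K₂
split-lp lp-nil [] = record
  { Δ₁ = emptyᶜ ; Δ₂ = emptyᶜ ; lp₁ = lp-nil ; lp₂ = lp-nil ; ctx = λ _ → ↭-refl ; size≡ = refl }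
split-lp (lp-cons {Γ' = Γ} z z∉ P lp) (consˡ i) = record
  { Δ₁ = (Γ ∖ z) ⊎ᶜ Δ₁ ; Δ₂ = Δ₂ ; lp₁ = lp-cons z z∉ P lp₁ ; lp₂ = lp₂
  ; ctx = λ y → ↭-trans (PermP.++⁺ˡ ((Γ ∖ z) y) (ctx y))
                        (↭-reflexive (sym (ListP.++-assoc ((Γ ∖ z) y) (Δ₁ y) (Δ₂ y))))
  ; size≡ = trans (ℕP.+-assoc (size P) (sizeLP lp₁) (sizeLP lp₂)) (cong (size P +_) size≡) }
  where open LPSplit (split-lp lp i)
split-lp (lp-cons {Γ' = Γ} z z∉ P lp) (consʳ i) = record
  { Δ₁ = Δ₁ ; Δ₂ = (Γ ∖ z) ⊎ᶜ Δ₂ ; lp₁ = lp₁ ; lp₂ = lp-cons z z∉ P lp₂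
  ; ctx = λ y → ↭-trans (PermP.++⁺ˡ ((Γ ∖ z) y) (ctx y)) (PermP.shifts ((Γ ∖ z) y) (Δ₁ y))
  ; size≡ = trans (+-Interchange.x∙yz≈y∙xz (sizeLP lp₁) (size P) (sizeLP lp₂)) (cong (size P +_) size≡) }
  where open LPSplit (split-lp lp i)

record ValueSplit {v Δ K} (Dv : Δ ⊢ v ∶ K) (K₁ K₂ : MType) : Set where
  field
    Δ₁ Δ₂ : TCtx
    D₁    : Δ₁ ⊢ v ∶ K₁
    D₂    : Δ₂ ⊢ v ∶ K₂
    ctx   : ∀ y → Δ y ↭ Δ₁ y ++ Δ₂ y
    size≡ : size D₁ + size D₂ ≡ size Dv

split-value : ∀ {v Δ K K₁ K₂} → Value v → (Dv : Δ ⊢ v ∶ K) → Interleaving K₁ K₂ K → ValueSplit Dv K₁ K₂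
split-value {K = K} {K₁} {K₂} (v-var w) (ax .w .K) i = record
  { Δ₁ = w ∶ K₁ ; Δ₂ = w ∶ K₂ ; D₁ = ax w K₁ ; D₂ = ax w K₂ ; ctx = ctx ; size≡ = refl }
  where ctx : ∀ y → (w ∶ K) y ↭ (w ∶ K₁) y ++ (w ∶ K₂) y
        ctx y with y ≟ w
        ... | yes _ = toPermutation i
        ... | no _  = ↭-refl
split-value (v-lam s) (lam lp) i = record
  { Δ₁ = Δ₁ ; Δ₂ = Δ₂ ; D₁ = lam lp₁ ; D₂ = lam lp₂ ; ctx = ctx ; size≡ = size≡ }
  where open LPSplit (split-lp lp i)

lp-++ : ∀ {s Δ₁ Δ₂ K₁ K₂} → LamPremises s Δ₁ K₁ → LamPremises s Δ₂ K₂ →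
        ∃ λ Δ → LamPremises s Δ (K₁ ++ K₂) × (∀ y → Δ y ≡ Δ₁ y ++ Δ₂ y)
lp-++ lp-nil lp₂ = _ , lp₂ , λ _ → refl
lp-++ {Δ₂ = Δ₂} (lp-cons {Γ' = Γ} {Δ = Δ'} z z∉ P lp) lp₂ with lp-++ lp lp₂
... | Δ , lp' , h = _ , lp-cons z z∉ P lp' ,
      λ y → trans (cong ((Γ ∖ z) y ++_) (h y)) (sym (ListP.++-assoc ((Γ ∖ z) y) (Δ' y) (Δ₂ y)))

record MergedValue (v : Term) (K : MType) (Δ₁ Δ₂ : TCtx) : Set where
  field
    Δ      : TCtx
    D      : Δ ⊢ v ∶ K
    unused : ∀ y → Δ y ≡ [] → Δ₁ y ≡ [] × Δ₂ y ≡ []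

merge-value : ∀ {v Δ₁ Δ₂ K₁ K₂} → Value v → Δ₁ ⊢ v ∶ K₁ → Δ₂ ⊢ v ∶ K₂ → MergedValue v (K₁ ++ K₂) Δ₁ Δ₂
merge-value {K₁ = K₁} {K₂} (v-var w) (ax .w .K₁) (ax .w .K₂) =
  record { Δ = _ ; D = ax w (K₁ ++ K₂) ; unused = unused }
  where unused : ∀ y → (w ∶ (K₁ ++ K₂)) y ≡ [] → (w ∶ K₁) y ≡ [] × (w ∶ K₂) y ≡ []
        unused y e with y ≟ w
        ... | yes _ = ++-conical K₁ K₂ e
        ... | no _  = refl , refl
merge-value {Δ₁ = Δ₁} {Δ₂} (v-lam s) (lam lp₁) (lam lp₂) with lp-++ lp₁ lp₂
... | Δ , lp , h = record { Δ = Δ ; D = lam lp ; unused = λ y e → ++-conical (Δ₁ y) (Δ₂ y) (trans (sym (h y)) e) }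

record AppTyping (Γ : TCtx) (t : Term) (N : MType) (n : ℕ) : Set where
  field
    N'    : MType
    D     : Γ ⊢ t ∶ N'
    tyeq  : N' ≈M N
    size≡ : size D ≡ n

app-≈ : ∀ {Γ₁ Γ₂ t u T M N M'} (Dt : Γ₁ ⊢ t ∶ T) → T ≈M [ M ⊸ N ] → (Du : Γ₂ ⊢ u ∶ M') → M' ≈M M →
        AppTyping (Γ₁ ⊎ᶜ Γ₂) (app t u) N (suc (size Dt + size Du))
app-≈ Dt T≈ Du M'≈ with ≈M-[-]⁻ T≈ refl
... | _ , refl , ⊸-cong M≈ N≈ = record
  { N' = _ ; D = app Dt Du (≈M-trans M'≈ (≈M-sym M≈)) ; tyeq = N≈ ; size≡ = refl }

record Substituted (x : Var) (v : Term) {Γ u N} (D : Γ ⊢ u ∶ N) {Δ K} (Dv : Δ ⊢ v ∶ K) : Set where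
  field
    Γ'    : TCtx
    N'    : MType
    D'    : Γ' ⊢ replace x v u ∶ N'
    tyeq  : N' ≈M N
    ctx   : ∀ y → Γ' y ↭ (Γ ∖ x) y ++ Δ y
    size≤ : size D' ≤ size D + size Dv

record SubstitutedLP (x : Var) (v : Term) {s Γ M} (lp : LamPremises s Γ M) {Δ K} (Dv : Δ ⊢ v ∶ K) : Set where
  field
    Γ'    : TCtx
    M'    : MType
    lp'   : LamPremises (replace x v s) Γ' M'
    tyeq  : M' ≈M M
    ctx   : ∀ y → Γ' y ↭ (Γ ∖ x) y ++ Δ y
    size≤ : sizeLP lp' ≤ sizeLP lp + size Dv

-- The derivation Dv of v is cut into one piece per occurrence of x, along
-- the multiset K ≈ Γ x of the types assigned to x.
mutual
  substitution : ∀ k x v → Value v → ∀ {Γ u N} (D : Γ ⊢ u ∶ N) → nodes D ≤ k →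
                 ∀ {Δ K} (Dv : Δ ⊢ v ∶ K) → K ≈M Γ x → Substituted x v D Dv
  substitution k x v val (ax y N) _ {Δ} {K} Dv K≈ with y ≟ x
  ... | yes refl = record
    { Γ' = Δ ; N' = K ; D' = ⊢-cast v≡ Dv
    ; tyeq = subst (_ ≈M_) (∶-self x N) K≈
    ; ctx = λ z → ↭-reflexive (sym (cong (_++ Δ z) (∶-∖-self x N z)))
    ; size≤ = ℕP.≤-reflexive (size-⊢-cast v≡ Dv) }
    where v≡ : v ≡ replace x v (fvar x)
          v≡ = sym (trans (replace-self x v) (weaken-zero v))
  ... | no y≢x with ≈M-[]⁻ K≈ (∶-other y N x (λ e → y≢x (sym e)))
  ...   | refl = record
    { Γ' = y ∶ N ; N' = N ; D' = ⊢-cast y≡ (ax y N) ; tyeq = ≈M-refl N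
    ; ctx = λ z → ↭-reflexive (sym (trans
              (cong₂ _++_ (∖-unbound (y ∶ N) x z (∶-other y N x (λ e → y≢x (sym e))))
                          (value-[]⁻ val Dv z))
              (ListP.++-identityʳ _)))
    ; size≤ = ℕP.≤-trans (ℕP.≤-reflexive (size-⊢-cast y≡ (ax y N))) z≤n }
    where y≡ : fvar y ≡ replace x v (fvar y)
          y≡ = sym (replace-other x v y y≢x)
  substitution (suc k) x v val (app {Γ = Γt} {Δ = Γu} {t} {u} {N = N} Dt Du eq) (s≤s nd) {Δ} Dv K≈
    with ≈M-split K≈ (Γt x) (Γu x) refl
  ... | K₁ , K₂ , i , K₁≈ , K₂≈ = record
    { Γ' = Substituted.Γ' st ⊎ᶜ Substituted.Γ' su ; N' = AppTyping.N' a ; D' = AppTyping.D a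
    ; tyeq = AppTyping.tyeq a
    ; ctx = λ y → ↭-trans
              (↭-interchange ((Γt ∖ x) y) ((Γu ∖ x) y)
                             (Substituted.ctx st y) (Substituted.ctx su y) (ValueSplit.ctx sp y))
              (↭-reflexive (cong (_++ Δ y) (sym (∖-⊎ᶜ Γt Γu x y))))
    ; size≤ = ℕP.≤-trans (ℕP.≤-reflexive (AppTyping.size≡ a))
                (s≤s (+-interchange-≤ (size Dt) (size Du) (size (ValueSplit.D₁ sp)) (size (ValueSplit.D₂ sp))
                        (Substituted.size≤ st) (Substituted.size≤ su) (ValueSplit.size≡ sp))) }
    where
      sp : ValueSplit Dv K₁ K₂
      sp = split-value val Dv i
      st : Substituted x v Dt (ValueSplit.D₁ sp)
      st = substitution k x v val Dt (ℕP.≤-trans (ℕP.m≤m+n _ _) nd) (ValueSplit.D₁ sp) K₁≈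
      su : Substituted x v Du (ValueSplit.D₂ sp)
      su = substitution k x v val Du (ℕP.≤-trans (ℕP.m≤n+m _ _) nd) (ValueSplit.D₂ sp) K₂≈
      a : AppTyping (Substituted.Γ' st ⊎ᶜ Substituted.Γ' su) (replace x v (app t u)) N
                    (suc (size (Substituted.D' st) + size (Substituted.D' su)))
      a = app-≈ (Substituted.D' st) (Substituted.tyeq st) (Substituted.D' su)
                (≈M-trans (Substituted.tyeq su) eq)
  substitution (suc k) x v val (lam lp) (s≤s nd) Dv K≈ = record
    { Γ' = Γ' ; N' = M' ; D' = lam lp' ; tyeq = tyeq ; ctx = ctx ; size≤ = size≤ }
    where open SubstitutedLP (substitution-lp k x v val lp nd Dv K≈)

  substitution-lp : ∀ k x v → Value v → ∀ {s Γ M} (lp : LamPremises s Γ M) → nodesLP lp ≤ k →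
                    ∀ {Δ K} (Dv : Δ ⊢ v ∶ K) → K ≈M Γ x → SubstitutedLP x v lp Dv
  substitution-lp k x v val lp-nil _ {Δ} Dv K≈ with ≈M-[]⁻ K≈ refl
  ... | refl = record
    { Γ' = emptyᶜ ; M' = [] ; lp' = lp-nil ; tyeq = []≈
    ; ctx = λ y → ↭-reflexive (sym (cong₂ _++_ (emptyᶜ-∖ x y) (value-[]⁻ val Dv y)))
    ; size≤ = z≤n }
  -- The bound name z may be x or occur in v, so the premise is first renamed to a fresh w.
  substitution-lp (suc k) x v val {s} (lp-cons {Γ' = Γ} {Δ = Γr} z z∉ P lp) (s≤s nd) {Δ} Dv K≈
    with ≈M-split K≈ ((Γ ∖ z) x) (Γr x) refl | fresh (lam s ∷ v ∷ fvar x ∷ [])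
  ... | K₁ , K₂ , i , K₁≈ , K₂≈ | w , w∉s ∷ w∉v ∷ w∉x ∷ [] = record
    { Γ'    = (Γ₂ ∖ w) ⊎ᶜ SubstitutedLP.Γ' sr
    ; M'    = (Γ₂ w ⊸ Substituted.N' sP) ∷ SubstitutedLP.M' sr
    ; lp'   = lp-cons w w∉s' P' (SubstitutedLP.lp' sr)
    ; tyeq  = ≈M-∷ (⊸-cong (↭⇒≈M (↭-trans (Substituted.ctx sP w) (↭-reflexive at-w))) (Substituted.tyeq sP))
                   (SubstitutedLP.tyeq sr)
    ; ctx   = λ y → ↭-trans
                (↭-interchange (((Γ ∖ z) ∖ x) y) ((Γr ∖ x) y)
                               (off-w y) (SubstitutedLP.ctx sr y) (ValueSplit.ctx sp y))
                (↭-reflexive (cong (_++ Δ y) (sym (∖-⊎ᶜ (Γ ∖ z) Γr x y))))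
    ; size≤ = +-interchange-≤ (size P) (sizeLP lp) (size (ValueSplit.D₁ sp)) (size (ValueSplit.D₂ sp))
                size-P' (SubstitutedLP.size≤ sr) (ValueSplit.size≡ sp) }
    where
      w≢x : w ≢ x
      w≢x = ¬Free-fvar w∉x
      B : Rebound s P w
      B = rebind P z∉ w∉s
      Γw : TCtx
      Γw = Rebound.Γ' B
      Γw-off : ∀ y → y ≢ w → Γw y ≡ (Γ ∖ z) y
      Γw-off y y≢w = trans (sym (∖-other Γw w y y≢w)) (Rebound.off-bound B y)
      sp : ValueSplit Dv K₁ K₂
      sp = split-value val Dv i
      Δ₁ : TCtx
      Δ₁ = ValueSplit.Δ₁ sp
      Δ₁w : Δ₁ w ≡ []
      Δ₁w = ¬Free⇒unused (ValueSplit.D₁ sp) w∉v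
      sP : Substituted x v (Rebound.D B) (ValueSplit.D₁ sp)
      sP = substitution k x v val (Rebound.D B)
             (ℕP.≤-trans (ℕP.≤-reflexive (Rebound.nodes≡ B)) (ℕP.≤-trans (ℕP.m≤m+n _ _) nd))
             (ValueSplit.D₁ sp) (subst (_ ≈M_) (sym (Γw-off x (λ e → w≢x (sym e)))) K₁≈)
      sr : SubstitutedLP x v lp (ValueSplit.D₂ sp)
      sr = substitution-lp k x v val lp (ℕP.≤-trans (ℕP.m≤n+m _ _) nd) (ValueSplit.D₂ sp) K₂≈
      Γ₂ : TCtx
      Γ₂ = Substituted.Γ' sP
      P' : Γ₂ ⊢ open₀ (replace x v s) (fvar w) ∶ Substituted.N' sP
      P' = ⊢-cast (replace-open x v w s w≢x) (Substituted.D' sP)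
      size-P' : size P' ≤ size P + size (ValueSplit.D₁ sp)
      size-P' = subst₂ (λ a b → a ≤ b + size (ValueSplit.D₁ sp))
                       (sym (size-⊢-cast (replace-open x v w s w≢x) (Substituted.D' sP))) (Rebound.size≡ B)
                       (Substituted.size≤ sP)
      w∉s' : ¬ Free w (lam (replace x v s))
      w∉s' (fv-lam f) with Free-replace⁻ x v s f
      ... | inj₁ (g , _) = w∉s (fv-lam g)
      ... | inj₂ g       = w∉v g
      at-w : (Γw ∖ x) w ++ Δ₁ w ≡ Γ z
      at-w = trans (cong₂ _++_ (trans (∖-other Γw x w w≢x) (Rebound.at-bound B)) Δ₁w) (ListP.++-identityʳ _)
      off-w : ∀ y → (Γ₂ ∖ w) y ↭ ((Γ ∖ z) ∖ x) y ++ Δ₁ y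
      off-w y with ∖-view Γ₂ w y
      ... | inj₁ (refl , e) = ↭-reflexive (trans e (sym (cong₂ _++_
              (trans (∖-other (Γ ∖ z) x w w≢x) (trans (sym (Rebound.off-bound B w)) (∖-self Γw w))) Δ₁w)))
      ... | inj₂ (y≢w , e) = ↭-trans (↭-reflexive e) (↭-trans (Substituted.ctx sP y)
              (↭-reflexive (cong (_++ Δ₁ y) (∖-agree (Γ ∖ z) Γw x y (λ _ → Γw-off y y≢w)))))

record AntiSubstituted (x : Var) (v u : Term) (Γ : TCtx) (N : MType) : Set where
  field
    Γ' Δ : TCtx
    D    : Γ' ⊢ u ∶ N
    Dv   : Δ ⊢ v ∶ Γ' x
    ctx  : ∀ y → y ≢ x → Δ y ≡ [] → Γ' y ≡ Γ y

record AntiSubstitutedLP (x : Var) (v : Term) (s : Tm 1) (Γ : TCtx) (M : MType) : Set where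
  field
    Γ' Δ : TCtx
    lp'  : LamPremises s Γ' M
    Dv   : Δ ⊢ v ∶ Γ' x
    ctx  : ∀ y → y ≢ x → Δ y ≡ [] → Γ' y ≡ Γ y

mutual
  anti-substitution : ∀ k x v → Value v → (u : Term) → ∀ {Γ N} (D : Γ ⊢ replace x v u ∶ N) →
                      nodes D ≤ k → AntiSubstituted x v u Γ N
  anti-substitution k x v val (fvar y) {Γ} {N} D _ with y ≟ x
  ... | yes refl = record
    { Γ' = x ∶ N ; Δ = Γ ; D = ax x N ; Dv = ⊢-castType (sym (∶-self x N)) (⊢-cast (weaken-zero v) D)
    ; ctx = λ y y≢x Γy≡[] → trans (∶-other x N y y≢x) (sym Γy≡[]) }
  anti-substitution k x v val (fvar y) (ax .y N) _ | no y≢x = record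
    { Γ' = y ∶ N ; Δ = proj₁ (value-typable-[] val) ; D = ax y N
    ; Dv = ⊢-castType (sym (∶-other y N x (λ e → y≢x (sym e)))) (proj₂ (value-typable-[] val))
    ; ctx = λ _ _ _ → refl }
  anti-substitution (suc k) x v val (app t u) (app {Γ = Γt} {Γu} {M = M} {M'} {N} Dt Du eq) (s≤s nd) = record
    { Γ' = AntiSubstituted.Γ' rt ⊎ᶜ AntiSubstituted.Γ' ru ; Δ = MergedValue.Δ m
    ; D = app (AntiSubstituted.D rt) (AntiSubstituted.D ru) eq ; Dv = MergedValue.D m
    ; ctx = λ y y≢x Δy≡[] → cong₂ _++_ (AntiSubstituted.ctx rt y y≢x (proj₁ (MergedValue.unused m y Δy≡[])))
                                         (AntiSubstituted.ctx ru y y≢x (proj₂ (MergedValue.unused m y Δy≡[]))) }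
    where
      rt : AntiSubstituted x v t Γt [ M ⊸ N ]
      rt = anti-substitution k x v val t Dt (ℕP.≤-trans (ℕP.m≤m+n _ _) nd)
      ru : AntiSubstituted x v u Γu M'
      ru = anti-substitution k x v val u Du (ℕP.≤-trans (ℕP.m≤n+m _ _) nd)
      m : MergedValue v (AntiSubstituted.Γ' rt x ++ AntiSubstituted.Γ' ru x)
                        (AntiSubstituted.Δ rt) (AntiSubstituted.Δ ru)
      m = merge-value val (AntiSubstituted.Dv rt) (AntiSubstituted.Dv ru)
  anti-substitution (suc k) x v val (lam s) (lam lp) (s≤s nd) = record
    { Γ' = Γ' ; Δ = Δ ; D = lam lp' ; Dv = Dv ; ctx = ctx }
    where open AntiSubstitutedLP (anti-substitution-lp k x v val s lp nd)

  anti-substitution-lp : ∀ k x v → Value v → (s : Tm 1) → ∀ {Γ M} (lp : LamPremises (replace x v s) Γ M) →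
                         nodesLP lp ≤ k → AntiSubstitutedLP x v s Γ M
  anti-substitution-lp k x v val s lp-nil _ = record
    { Γ' = emptyᶜ ; Δ = proj₁ (value-typable-[] val) ; lp' = lp-nil
    ; Dv = proj₂ (value-typable-[] val) ; ctx = λ _ _ _ → refl }
  anti-substitution-lp (suc k) x v val s (lp-cons {Γ' = Γ} {Δ = Γr} {N = N} {M = M} z z∉ P lp) (s≤s nd)
    with fresh (lam s ∷ lam (replace x v s) ∷ v ∷ fvar x ∷ [])
  ... | w , w∉s ∷ w∉s' ∷ w∉v ∷ w∉x ∷ [] = record
    { Γ' = (Γ₁ ∖ w) ⊎ᶜ AntiSubstitutedLP.Γ' rr ; Δ = MergedValue.Δ m
    ; lp' = lp-cons′ w w∉s (AntiSubstituted.D r) (AntiSubstitutedLP.lp' rr) at-w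
    ; Dv = MergedValue.D m
    ; ctx = λ y y≢x Δy≡[] → cong₂ _++_
              (trans (∖-agree (Rebound.Γ' B) Γ₁ w y
                        (λ _ → AntiSubstituted.ctx r y y≢x (proj₁ (MergedValue.unused m y Δy≡[]))))
                     (Rebound.off-bound B y))
              (AntiSubstitutedLP.ctx rr y y≢x (proj₂ (MergedValue.unused m y Δy≡[]))) }
    where
      w≢x : w ≢ x
      w≢x = ¬Free-fvar w∉x
      B : Rebound (replace x v s) P w
      B = rebind P z∉ w∉s'
      D≡ : open₀ (replace x v s) (fvar w) ≡ replace x v (open₀ s (fvar w))
      D≡ = sym (replace-open x v w s w≢x)
      r : AntiSubstituted x v (open₀ s (fvar w)) (Rebound.Γ' B) N
      r = anti-substitution k x v val (open₀ s (fvar w)) (⊢-cast D≡ (Rebound.D B))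
            (ℕP.≤-trans (ℕP.≤-reflexive (trans (nodes-⊢-cast D≡ (Rebound.D B)) (Rebound.nodes≡ B)))
                        (ℕP.≤-trans (ℕP.m≤m+n _ _) nd))
      rr : AntiSubstitutedLP x v s Γr M
      rr = anti-substitution-lp k x v val s lp (ℕP.≤-trans (ℕP.m≤n+m _ _) nd)
      Γ₁ : TCtx
      Γ₁ = AntiSubstituted.Γ' r
      m : MergedValue v ((Γ₁ ∖ w) x ++ AntiSubstitutedLP.Γ' rr x) (AntiSubstituted.Δ r) (AntiSubstitutedLP.Δ rr)
      m = merge-value val (⊢-castType (sym (∖-other Γ₁ w x (λ e → w≢x (sym e)))) (AntiSubstituted.Dv r))
                          (AntiSubstitutedLP.Dv rr)
      at-w : Γ₁ w ≡ Γ z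
      at-w = trans (AntiSubstituted.ctx r w w≢x (¬Free⇒unused (AntiSubstituted.Dv r) w∉v)) (Rebound.at-bound B)

-- Evaluation contexts and environments

record Plugged (C : Ctx) (a' : Term) (Γc : TCtx) (N : MType) (sc : ℕ) {Γa' Na'} (Da' : Γa' ⊢ a' ∶ Na') : Set where
  field
    Γ'    : TCtx
    N'    : MType
    D'    : Γ' ⊢ plug C a' ∶ N'
    tyeq  : N' ≈M N
    ctx   : ∀ y → Γ' y ↭ Γc y ++ Γa' y
    size≡ : size D' ≡ sc + size Da'

record Decomposed (C : Ctx) (a : Term) {Γ N} (D : Γ ⊢ plug C a ∶ N) : Set where
  field
    Γc Γa : TCtx
    Na    : MType
    Da    : Γa ⊢ a ∶ Na
    ctx   : ∀ y → Γ y ↭ Γc y ++ Γa y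
    sc    : ℕ
    size≡ : size D ≡ sc + size Da
    plugIn : ∀ {a' Γa' Na'} (Da' : Γa' ⊢ a' ∶ Na') → Na' ≈M Na → Plugged C a' Γc N sc Da'

decompose : ∀ C a {Γ N} (D : Γ ⊢ plug C a ∶ N) → Decomposed C a D
decompose hole a D = record
  { Γc = emptyᶜ ; Γa = _ ; Na = _ ; Da = D ; ctx = λ _ → ↭-refl ; sc = 0 ; size≡ = refl
  ; plugIn = λ Da' e → record { Γ' = _ ; N' = _ ; D' = Da' ; tyeq = e ; ctx = λ _ → ↭-refl ; size≡ = refl } }
decompose (appL t C) a (app {Γ = Γt} Dt Du eq) = record
  { Γc = Γt ⊎ᶜ Γc ; Γa = Γa ; Na = Na ; Da = Da
  ; ctx = λ y → ↭-trans (PermP.++⁺ˡ (Γt y) (ctx y)) (↭-reflexive (sym (ListP.++-assoc (Γt y) _ _)))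
  ; sc = suc (size Dt + sc)
  ; size≡ = cong suc (trans (cong (size Dt +_) size≡) (sym (ℕP.+-assoc (size Dt) _ _)))
  ; plugIn = λ Da' e → let f = plugIn Da' e in record
      { Γ' = Γt ⊎ᶜ Plugged.Γ' f ; N' = _ ; D' = app Dt (Plugged.D' f) (≈M-trans (Plugged.tyeq f) eq)
      ; tyeq = ≈M-refl _
      ; ctx = λ y → ↭-trans (PermP.++⁺ˡ (Γt y) (Plugged.ctx f y)) (↭-reflexive (sym (ListP.++-assoc (Γt y) _ _)))
      ; size≡ = cong suc (trans (cong (size Dt +_) (Plugged.size≡ f)) (sym (ℕP.+-assoc (size Dt) _ _))) } }
  where open Decomposed (decompose C a Du)
decompose (appR C f _) a (app {Δ = Γu} Dt Du eq) = record
  { Γc = Γc ⊎ᶜ Γu ; Γa = Γa ; Na = Na ; Da = Da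
  ; ctx = λ y → ↭-trans (PermP.++⁺ʳ (Γu y) (ctx y)) (++-Interchange.xy∙z≈xz∙y (Γc y) _ (Γu y))
  ; sc = suc (sc + size Du)
  ; size≡ = cong suc (trans (cong (_+ size Du) size≡) (+-Interchange.xy∙z≈xz∙y sc _ (size Du)))
  ; plugIn = λ Da' e → let g = plugIn Da' e
                           h = app-≈ (Plugged.D' g) (Plugged.tyeq g) Du eq in record
      { Γ' = Plugged.Γ' g ⊎ᶜ Γu ; N' = AppTyping.N' h ; D' = AppTyping.D h ; tyeq = AppTyping.tyeq h
      ; ctx = λ y → ↭-trans (PermP.++⁺ʳ (Γu y) (Plugged.ctx g y)) (++-Interchange.xy∙z≈xz∙y (Γc y) _ (Γu y))
      ; size≡ = trans (AppTyping.size≡ h)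
                  (cong suc (trans (cong (_+ size Du) (Plugged.size≡ g))
                                   (+-Interchange.xy∙z≈xz∙y sc _ (size Du)))) } }
  where open Decomposed (decompose C a Dt)

-- EnvTyping Γ₀ E Γ: the rules (es@) for the entries of E, applied from the
-- innermost (leftmost) entry outwards, turn a context Γ₀ for the term into Γ.
data EnvTyping : TCtx → Env → TCtx → Set where
  []    : ∀ {Γ} → EnvTyping Γ [] Γ
  entry : ∀ {Γ Δ Γ' M E} e → Δ ⊢ eterm e ∶ M → M ≈M Γ (evar e) →
          EnvTyping ((Γ ∖ evar e) ⊎ᶜ Δ) E Γ' → EnvTyping Γ (e ∷ E) Γ'

EnvTyping-snoc : ∀ {Γ₀ E Γ Δ M} e → EnvTyping Γ₀ E Γ → Δ ⊢ eterm e ∶ M → M ≈M Γ (evar e) →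
                 EnvTyping Γ₀ (E ++ [ e ]) ((Γ ∖ evar e) ⊎ᶜ Δ)
EnvTyping-snoc e []                    De eq = entry e De eq []
EnvTyping-snoc e (entry e' De' eq' Et) De eq = entry e' De' eq' (EnvTyping-snoc e Et De eq)

⊢ₚ⇒EnvTyping : ∀ {Γ t E N} → Γ ⊢ₚ (t , E) ∶ N → ∃ λ Γ₀ → (Γ₀ ⊢ t ∶ N) × EnvTyping Γ₀ E Γ
⊢ₚ⇒EnvTyping (es-ε D) = _ , D , []
⊢ₚ⇒EnvTyping (es-snoc e D De eq) with ⊢ₚ⇒EnvTyping D
... | Γ₀ , D₀ , Et = Γ₀ , D₀ , EnvTyping-snoc e Et De eq

EnvTyping⇒⊢ₚ : ∀ {Γ₁ Γ t E₁ E₂ N} → Γ₁ ⊢ₚ (t , E₁) ∶ N → EnvTyping Γ₁ E₂ Γ → Γ ⊢ₚ (t , E₁ ++ E₂) ∶ N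
EnvTyping⇒⊢ₚ {t = t} {E₁} D [] = subst (λ E → _ ⊢ₚ (t , E) ∶ _) (sym (ListP.++-identityʳ E₁)) D
EnvTyping⇒⊢ₚ {t = t} {E₁} D (entry {E = E₂} e De eq Et) =
  subst (λ E → _ ⊢ₚ (t , E) ∶ _) (ListP.++-assoc E₁ [ e ] E₂) (EnvTyping⇒⊢ₚ (es-snoc e D De eq) Et)

EnvTyping-↭ : ∀ {Γ₀ E Γ} → EnvTyping Γ₀ E Γ → ∀ Γ₀' → (∀ y → Γ₀' y ↭ Γ₀ y) → ∃ λ Γ' → EnvTyping Γ₀' E Γ'
EnvTyping-↭ [] Γ₀' _ = Γ₀' , []
EnvTyping-↭ (entry {Δ = Δ} e De eq Et) Γ₀' h with EnvTyping-↭ Et ((Γ₀' ∖ evar e) ⊎ᶜ Δ)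
  (λ y → PermP.++⁺ʳ (Δ y) (∖-↭ Γ₀' _ (evar e) h y))
... | Γ' , Et' = Γ' , entry e De (≈M-trans eq (↭⇒≈M (↭-sym (h (evar e))))) Et'

envTyping : ∀ Γ₀ E → ∃ λ Γ → EnvTyping Γ₀ E Γ
envTyping Γ₀ []      = Γ₀ , []
envTyping Γ₀ (e ∷ E) with inert-typable (inert e) (Γ₀ (evar e))
... | Δ , De with envTyping ((Γ₀ ∖ evar e) ⊎ᶜ Δ) E
...   | Γ , Et = Γ , entry e De (≈M-refl _) Et

-- Inert terms have every multi type, so a typing of the term extends to the program.
term-typable⇒Typable : ∀ {Γ₀ t N} → Γ₀ ⊢ t ∶ N → ∀ E → Typable (t , E)
term-typable⇒Typable {N = N} D E with envTyping _ E
... | Γ , Et = Γ , N , EnvTyping⇒⊢ₚ (es-ε D) Et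

-- Fresh names and progress

FreeP-++⁺ : ∀ {y t E₁} E₂ → FreeP y (t , E₁) → ¬ InDom y E₂ → FreeP y (t , E₁ ++ E₂)
FreeP-++⁺ {y} {t} {E₁} []       f _   = subst (λ E → FreeP y (t , E)) (sym (ListP.++-identityʳ E₁)) f
FreeP-++⁺ {y} {t} {E₁} (e ∷ E₂) f y∉ =
  subst (λ E → FreeP y (t , E)) (ListP.++-assoc E₁ [ e ] E₂)
    (FreeP-++⁺ E₂ (fvp-snocl f (λ eq → y∉ (here (sym eq)))) (λ d → y∉ (there d)))

maxFreeEnv : Env → ℕ
maxFreeEnv []      = 0
maxFreeEnv (e ∷ E) = evar e ⊔ (maxFree (eterm e) ⊔ maxFreeEnv E)

maxFreeEnv-++ : ∀ E E' → maxFreeEnv E ≤ maxFreeEnv (E ++ E')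
maxFreeEnv-++ []      E' = z≤n
maxFreeEnv-++ (e ∷ E) E' = ℕP.⊔-monoʳ-≤ (evar e) (ℕP.⊔-monoʳ-≤ (maxFree (eterm e)) (maxFreeEnv-++ E E'))

maxFreeEnv-last : ∀ E e → maxFree (eterm e) ≤ maxFreeEnv (E ++ [ e ])
maxFreeEnv-last []       e = ℕP.≤-trans (ℕP.m≤m⊔n _ _) (ℕP.m≤n⊔m (evar e) _)
maxFreeEnv-last (e' ∷ E) e =
  ℕP.≤-trans (maxFreeEnv-last E e) (ℕP.≤-trans (ℕP.m≤n⊔m (maxFree (eterm e')) _) (ℕP.m≤n⊔m (evar e') _))

FreeP⇒≤ : ∀ {y t E} → FreeP y (t , E) → y ≤ maxFree t ⊔ maxFreeEnv E
FreeP⇒≤ (fvp-ε {t} f) = ℕP.≤-trans (Free⇒≤maxFree t f) (ℕP.m≤m⊔n _ _)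
FreeP⇒≤ (fvp-snocl {t} {E} {e} f _) = ℕP.≤-trans (FreeP⇒≤ f) (ℕP.⊔-monoʳ-≤ (maxFree t) (maxFreeEnv-++ E [ e ]))
FreeP⇒≤ (fvp-snocr {t} {E} {e} f) =
  ℕP.≤-trans (Free⇒≤maxFree (eterm e) f) (ℕP.≤-trans (maxFreeEnv-last E e) (ℕP.m≤n⊔m (maxFree t) _))

InDom⇒≤ : ∀ {x E} → InDom x E → x ≤ maxFreeEnv E
InDom⇒≤ (here refl) = ℕP.m≤m⊔n _ _
InDom⇒≤ {E = e ∷ E} (there d) =
  ℕP.≤-trans (InDom⇒≤ d) (ℕP.≤-trans (ℕP.m≤n⊔m (maxFree (eterm e)) _) (ℕP.m≤n⊔m (evar e) _))

freshP : ∀ t E → ∃ λ x → ¬ FreeP x (t , E) × ¬ InDom x E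
freshP t E = suc m , (λ f → ℕP.<-irrefl refl (s≤s (FreeP⇒≤ f)))
                   , (λ d → ℕP.<-irrefl refl (s≤s (ℕP.≤-trans (InDom⇒≤ d) (ℕP.m≤n⊔m (maxFree t) _))))
  where m : ℕ
        m = maxFree t ⊔ maxFreeEnv E

data Progress (t : Term) : Set where
  done  : Fireball t → Progress t
  redex : ∀ C s a → Fireball a → t ≡ plug C (app (lam s) a) → Progress t

progress : ∀ (t : Term) → Progress t
progress (fvar x) = done (fb-val (v-var x))
progress (lam s)  = done (fb-val (v-lam s))
progress (app t u) with progress u
... | redex C s a fa eq = redex (appL t C) s a fa (cong (app t) eq)
... | done fu with progress t
...   | redex C s a fa eq           = redex (appR C u fu) s a fa (cong (λ q → app q u) eq)
...   | done (fb-val (v-var x))    = done (fb-inert (in-var x fu))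
...   | done (fb-val (v-lam s))    = redex hole s u fu refl
...   | done (fb-inert i)          = done (fb-inert (in-app i fu))

¬Value-redex : ∀ C s a → ¬ Value (plug C (app (lam s) a))
¬Value-redex hole       s a ()
¬Value-redex (appL t C) s a ()
¬Value-redex (appR C f _) s a ()

mutual
  ¬Inert-redex : ∀ C s a → Fireball a → ¬ Inert (plug C (app (lam s) a))
  ¬Inert-redex hole s a fa (in-app () _)
  ¬Inert-redex (appL t C) s a fa (in-var x f) = ¬Fireball-redex C s a fa f
  ¬Inert-redex (appL t C) s a fa (in-app i f) = ¬Fireball-redex C s a fa f
  ¬Inert-redex (appR hole f _)         s a fa (in-app i _) = ¬Inert-redex hole s a fa i
  ¬Inert-redex (appR (appL t C) f _)   s a fa (in-app i _) = ¬Inert-redex (appL t C) s a fa i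
  ¬Inert-redex (appR (appR C g gb) f _) s a fa (in-app i _) = ¬Inert-redex (appR C g gb) s a fa i

  ¬Fireball-redex : ∀ C s a → Fireball a → ¬ Fireball (plug C (app (lam s) a))
  ¬Fireball-redex C s a fa (fb-val v)   = ¬Value-redex C s a v
  ¬Fireball-redex C s a fa (fb-inert i) = ¬Inert-redex C s a fa i

Fireball⇒Normal : ∀ {t E} → Fireball t → Normal (t , E)
Fireball⇒Normal f _ (βv C s E val)        = ¬Fireball-redex C s _ (fb-val val) f
Fireball⇒Normal f _ (βi C s E ii x _ _)  = ¬Fireball-redex C s _ (fb-inert ii) f

fireball-or-step : ∀ t E → Fireball t ⊎ ∃ λ p' → (t , E) ⟶βf p'
fireball-or-step t E with progress t
... | done f = inj₁ f
... | redex C s a (fb-val val) refl = inj₂ (_ , βv C s E val)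
... | redex C s a (fb-inert ii) refl with freshP (plug C (app (lam s) a)) E
...   | x , x∉p , x∉E = inj₂ (_ , βi C s E ii x x∉p x∉E)

-- Subject reduction and subject expansion

record RedexTyping (s : Tm 1) (a : Term) (Γa : TCtx) (Na : MType) (n : ℕ) : Set where
  field
    z     : Var
    z∉    : ¬ Free z (lam s)
    Γ Δ   : TCtx
    P     : Γ ⊢ open₀ s (fvar z) ∶ Na
    M     : MType
    Darg  : Δ ⊢ a ∶ M
    tyeq  : M ≈M Γ z
    ctx   : ∀ y → Γa y ≡ (Γ ∖ z) y ++ Δ y
    size≡ : n ≡ suc (size P + size Darg)

-- The abstraction has the singleton type [M ⊸ Na], hence exactly one premise.
redex-typing : ∀ {s a Γa Na} (Da : Γa ⊢ app (lam s) a ∶ Na) → RedexTyping s a Γa Na (size Da)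
redex-typing (app {Δ = Δ} (lam (lp-cons {Γ' = Γ} z z∉ P lp-nil)) Darg eq) = record
  { z = z ; z∉ = z∉ ; Γ = Γ ; Δ = Δ ; P = P ; M = _ ; Darg = Darg ; tyeq = eq
  ; ctx = λ y → cong (_++ Δ y) (ListP.++-identityʳ _)
  ; size≡ = cong suc (cong (_+ size Darg) (ℕP.+-identityʳ (size P))) }

record SplitTyping (t : Term) (E : Env) : Set where
  field
    Γ₀ Γ : TCtx
    N    : MType
    D    : Γ₀ ⊢ t ∶ N
    env  : EnvTyping Γ₀ E Γ

weight : ∀ {t E} → SplitTyping t E → ℕ
weight T = size (SplitTyping.D T)

Typable⇒SplitTyping : ∀ {t E} → Typable (t , E) → SplitTyping t E
Typable⇒SplitTyping (Γ , N , D) with ⊢ₚ⇒EnvTyping D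
... | Γ₀ , D₀ , Et = record { Γ₀ = Γ₀ ; Γ = Γ ; N = N ; D = D₀ ; env = Et }

plug-size< : ∀ sc {n m k} → n ≤ m → k ≡ suc m → sc + n < sc + k
plug-size< sc n≤m refl = ℕP.+-monoʳ-< sc (s≤s n≤m)

subject-reduction : ∀ {t E t' E'} → (t , E) ⟶βf (t' , E') → (T : SplitTyping t E) →
                    Σ (SplitTyping t' E') λ T' → weight T' < weight T
subject-reduction (βv C s {v} E val) T =
  record { Γ₀ = Plugged.Γ' pl ; N = _ ; D = Plugged.D' pl ; env = proj₂ env' } , smaller
  where
    open SplitTyping T using (Γ₀; N; D; env)
    dc : Decomposed C (app (lam s) v) D
    dc = decompose C (app (lam s) v) D
    open Decomposed dc using (Γc; Da; sc; plugIn)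
    open RedexTyping (redex-typing Da)
    sb : Substituted z v P Darg
    sb = substitution (nodes P) z v val P ℕP.≤-refl Darg tyeq
    P≡ : replace z v (open₀ s (fvar z)) ≡ open₀ s v
    P≡ = sym (open-replace z v s z∉)
    pl : Plugged C (open₀ s v) Γc N sc (⊢-cast P≡ (Substituted.D' sb))
    pl = plugIn (⊢-cast P≡ (Substituted.D' sb)) (Substituted.tyeq sb)
    ctx₀ : ∀ y → Plugged.Γ' pl y ↭ Γ₀ y
    ctx₀ y = begin
      Plugged.Γ' pl y                   ↭⟨ Plugged.ctx pl y ⟩
      Γc y ++ Substituted.Γ' sb y         ↭⟨ PermP.++⁺ˡ (Γc y) (Substituted.ctx sb y) ⟩
      Γc y ++ ((Γ ∖ z) y ++ Δ y)          ≡⟨ cong (Γc y ++_) (ctx y) ⟨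
      Γc y ++ Decomposed.Γa dc y          ↭⟨ ↭-sym (Decomposed.ctx dc y) ⟩
      Γ₀ y                              ∎
      where open Perm.PermutationReasoning
    env' : ∃ λ Γ → EnvTyping (Plugged.Γ' pl) E Γ
    env' = EnvTyping-↭ env (Plugged.Γ' pl) ctx₀
    smaller : size (Plugged.D' pl) < size D
    smaller = subst₂ _<_ (sym (trans (Plugged.size≡ pl) (cong (sc +_) (size-⊢-cast P≡ (Substituted.D' sb)))))
                         (sym (Decomposed.size≡ dc))
                         (plug-size< sc (Substituted.size≤ sb) size≡)
subject-reduction (βi C s {a} E ii x x∉p x∉E) T =
  record { Γ₀ = Γ' ; N = _ ; D = Plugged.D' pl
         ; env = entry [ x ← a ∣ ii ] Darg tyeq' (proj₂ env') } , smaller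
  where
    open SplitTyping T using (Γ₀; N; D; env)
    dc : Decomposed C (app (lam s) a) D
    dc = decompose C (app (lam s) a) D
    open Decomposed dc using (Γc; Γa; Da; sc; plugIn)
    open RedexTyping (redex-typing Da)
    x∉t : ¬ Free x (plug C (app (lam s) a))
    x∉t f = x∉p (FreeP-++⁺ E (fvp-ε f) x∉E)
    B : Rebound s P x
    B = rebind P z∉ (λ f → x∉t (Free-plug⁺ C (fv-appl f)))
    Γw : TCtx
    Γw = Rebound.Γ' B
    pl : Plugged C (open₀ s (fvar x)) Γc N sc (Rebound.D B)
    pl = plugIn (Rebound.D B) (≈M-refl _)
    Γ' : TCtx
    Γ' = Plugged.Γ' pl
    Γcx : Γc x ≡ []
    Γcx = ListP.++-conicalˡ (Γc x) (Γa x) (PermP.↭-empty-inv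
            (↭-trans (↭-sym (Decomposed.ctx dc x)) (↭-reflexive (¬Free⇒unused D x∉t))))
    tyeq' : M ≈M Γ' x
    tyeq' = ≈M-trans tyeq (↭⇒≈M (↭-sym (↭-trans (Plugged.ctx pl x)
              (↭-reflexive (cong₂ _++_ Γcx (Rebound.at-bound B))))))
    ctx₀ : ∀ y → ((Γ' ∖ x) ⊎ᶜ Δ) y ↭ Γ₀ y
    ctx₀ y = begin
      (Γ' ∖ x) y ++ Δ y               ↭⟨ PermP.++⁺ʳ (Δ y) (∖-↭ Γ' (Γc ⊎ᶜ Γw) x (Plugged.ctx pl) y) ⟩
      ((Γc ⊎ᶜ Γw) ∖ x) y ++ Δ y       ≡⟨ cong (_++ Δ y) (∖-⊎ᶜ Γc Γw x y) ⟩
      ((Γc ∖ x) y ++ (Γw ∖ x) y) ++ Δ y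
        ≡⟨ cong (_++ Δ y) (cong₂ _++_ (∖-unbound Γc x y Γcx) (Rebound.off-bound B y)) ⟩
      (Γc y ++ (Γ ∖ z) y) ++ Δ y      ≡⟨ ListP.++-assoc (Γc y) _ _ ⟩
      Γc y ++ ((Γ ∖ z) y ++ Δ y)      ≡⟨ cong (Γc y ++_) (ctx y) ⟨
      Γc y ++ Γa y                    ↭⟨ ↭-sym (Decomposed.ctx dc y) ⟩
      Γ₀ y                            ∎
      where open Perm.PermutationReasoning
    env' : ∃ λ Γ → EnvTyping ((Γ' ∖ x) ⊎ᶜ Δ) E Γ
    env' = EnvTyping-↭ env _ ctx₀
    smaller : size (Plugged.D' pl) < size D
    smaller = subst₂ _<_ (sym (trans (Plugged.size≡ pl) (cong (sc +_) (Rebound.size≡ B))))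
                         (sym (Decomposed.size≡ dc))
                         (plug-size< sc (ℕP.m≤m+n (size P) (size Darg)) size≡)

SplitTyping⇒Terminates : ∀ n {t E} (T : SplitTyping t E) → weight T < n → Terminates (t , E)
SplitTyping⇒Terminates (suc n) {t} {E} T (s≤s T<n) with fireball-or-step t E
... | inj₁ f = (t , E) , ε , Fireball⇒Normal f
... | inj₂ (p' , step) with subject-reduction step T
...   | T' , T'<T with SplitTyping⇒Terminates n T' (ℕP.<-≤-trans T'<T T<n)
...     | q , steps , q-normal = q , step ◅ steps , q-normal

Typable⇒Terminates : ∀ p → Typable p → Terminates p
Typable⇒Terminates (t , E) ty = SplitTyping⇒Terminates (suc (weight T)) T ℕP.≤-refl
  where T : SplitTyping t E
        T = Typable⇒SplitTyping ty

Normal⇒Typable : ∀ q → Normal q → Typable q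
Normal⇒Typable (t , E) q-normal with fireball-or-step t E
... | inj₁ f           = term-typable⇒Typable (proj₂ (fireball-typable-[] f)) E
... | inj₂ (_ , step)  = ⊥-elim (q-normal _ step)

subject-expansion : ∀ {p p'} → p ⟶βf p' → Typable p' → Typable p
subject-expansion (βv C s {v} E val) ty = term-typable⇒Typable (Plugged.D' pl) E
  where
    open SplitTyping (Typable⇒SplitTyping ty) using (N; D)
    open Decomposed (decompose C (open₀ s v) D)
    x : Var
    x = proj₁ (fresh (lam s ∷ []))
    x∉s : ¬ Free x (lam s)
    x∉s = All.head (proj₂ (fresh (lam s ∷ [])))
    Da≡ : open₀ s v ≡ replace x v (open₀ s (fvar x))
    Da≡ = open-replace x v s x∉s
    r : AntiSubstituted x v (open₀ s (fvar x)) Γa Na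
    r = anti-substitution (nodes (⊢-cast Da≡ Da)) x v val (open₀ s (fvar x)) (⊢-cast Da≡ Da) ℕP.≤-refl
    Dredex : (((AntiSubstituted.Γ' r ∖ x) ⊎ᶜ emptyᶜ) ⊎ᶜ AntiSubstituted.Δ r) ⊢ app (lam s) v ∶ Na
    Dredex = app (lam (lp-cons x x∉s (AntiSubstituted.D r) lp-nil)) (AntiSubstituted.Dv r) (≈M-refl _)
    pl : Plugged C (app (lam s) v) Γc N sc Dredex
    pl = plugIn Dredex (≈M-refl _)
subject-expansion (βi C s {i} E ii x x∉p x∉E) ty = term-typable⇒Typable (Plugged.D' pl) E
  where
    open SplitTyping (Typable⇒SplitTyping ty) using (N; D)
    open Decomposed (decompose C (open₀ s (fvar x)) D)
    x∉s : ¬ Free x (lam s)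
    x∉s f = x∉p (FreeP-++⁺ E (fvp-ε (Free-plug⁺ C (fv-appl f))) x∉E)
    Dredex : (((Γa ∖ x) ⊎ᶜ emptyᶜ) ⊎ᶜ proj₁ (inert-typable ii (Γa x))) ⊢ app (lam s) i ∶ Na
    Dredex = app (lam (lp-cons x x∉s Da lp-nil)) (proj₂ (inert-typable ii (Γa x))) (≈M-refl _)
    pl : Plugged C (app (lam s) i) Γc N sc Dredex
    pl = plugIn Dredex (≈M-refl _)

Terminates⇒Typable : ∀ p → Terminates p → Typable p
Terminates⇒Typable p (q , steps , q-normal) = expand steps
  where
    expand : ∀ {p} → p ⟶βf* q → Typable p
    expand ε              = Normal⇒Typable q q-normal
    expand (step ◅ steps) = subject-expansion step (expand steps)

-- The semantics of a program

typedP⇒FreeP : ∀ {Γ p N} → Γ ⊢ₚ p ∶ N → ∀ y → Γ y ≢ [] → FreeP y p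
typedP⇒FreeP (es-ε D) y h = fvp-ε (typed⇒Free D y h)
typedP⇒FreeP (es-snoc {Γ' = Γ} {Δ} e D De _) y h with ++-≢[] ((Γ ∖ evar e) y) (Δ y) h
... | inj₂ g = fvp-snocr (typed⇒Free De y g)
... | inj₁ g with ∖-view Γ (evar e) y
...   | inj₁ (_ , e≡)    = ⊥-elim (g e≡)
...   | inj₂ (y≢ , e≡)  = fvp-snocl (typedP⇒FreeP D y (λ e' → g (trans e≡ e'))) y≢

restrict : TCtx → (xs : List Var) → Vec MType (length xs)
restrict Γ []       = []
restrict Γ (x ∷ xs) = Γ x ∷ restrict Γ xs

ctxOf-restrict-∉ : ∀ Γ xs y → y ∉ xs → ctxOf xs (restrict Γ xs) y ≡ []
ctxOf-restrict-∉ Γ []       y _   = refl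
ctxOf-restrict-∉ Γ (x ∷ xs) y y∉ =
  cong₂ _++_ (∶-other x (Γ x) y (λ e → y∉ (Any.here e))) (ctxOf-restrict-∉ Γ xs y (λ m → y∉ (Any.there m)))

ctxOf-restrict-∈ : ∀ Γ xs → Unique xs → ∀ y → y ∈ xs → ctxOf xs (restrict Γ xs) y ≡ Γ y
ctxOf-restrict-∈ Γ (x ∷ xs) (x∉xs ∷ _) y (Any.here refl) =
  trans (cong₂ _++_ (∶-self x (Γ x)) (ctxOf-restrict-∉ Γ xs x (λ m → All.lookup x∉xs m refl)))
        (ListP.++-identityʳ _)
ctxOf-restrict-∈ Γ (x ∷ xs) (x∉xs ∷ u) y (Any.there m) =
  cong₂ _++_ (∶-other x (Γ x) y (λ e → All.lookup x∉xs m (sym e))) (ctxOf-restrict-∈ Γ xs u y m)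

-- A suitable list contains every variable a typing context can use.
Typable⇒SemNonEmpty : ∀ xs p → Suitable xs p → Typable p → SemNonEmpty xs p
Typable⇒SemNonEmpty xs p (unique , fv⊆xs) (Γ , N , D) = restrict Γ xs , N , Γ , D , agree
  where
    agree : ∀ y → Γ y ≈M ctxOf xs (restrict Γ xs) y
    agree y with y ∈? xs
    ... | yes y∈ = subst (Γ y ≈M_) (sym (ctxOf-restrict-∈ Γ xs unique y y∈)) (≈M-refl _)
    ... | no y∉  = subst₂ _≈M_ (sym Γy≡[]) (sym (ctxOf-restrict-∉ Γ xs y y∉)) []≈
      where Γy≡[] : Γ y ≡ []
            Γy≡[] = ¬≢[]⇒≡[] (Γ y) (λ h → y∉ (fv⊆xs y (typedP⇒FreeP D y h)))

SemNonEmpty⇒Typable : ∀ xs p → SemNonEmpty xs p → Typable p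
SemNonEmpty⇒Typable xs p (_ , N , Γ , D , _) = Γ , N , D

corollary2 : (p : Prog) (xs : List Var) → Suitable xs p →
    (Terminates p ⇔ Typable p) × (Typable p ⇔ SemNonEmpty xs p)
corollary2 p xs suitable =
  mk⇔ (Terminates⇒Typable p) (Typable⇒Terminates p) ,
  mk⇔ (Typable⇒SemNonEmpty xs p suitable) (SemNonEmpty⇒Typable xs p)
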